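{- Let $S$ be a closed surface with Euler characteristic $\chi(S)=-1$ (i.e. $S\cong \#_3\mathbb{RP}^2$), and let $\Gamma$ be a semi-equivelar graph embedded regularly on $S$. Then $\Gamma$ is of one of the following types: $[(4^5);4]$, $[(4^3,8);8]$, $[(4^3,6);12]$, $[(8^3);8]$, $[(6^2,8);24]$, $[(6^2,12);12]$, $[(10^2,4);20]$, $[(12^2,4);12]$, $[(4,6,14);84]$, $[(4,6,16);48]$, $[(4,6,18);36]$, $[(4,6,24);24]$, $[(4,8,10);40]$, $[(4,8,12);24]$, or $[(4,8,16);16]$.
   Context: A $(d+1)$-regular colored graph is a pair $(\Gamma,\gamma)$ where $\Gamma$ is a finite $(d+1)$-regular multigraph without loops and $\gamma:E(\Gamma)\to\Delta_d=\{0,1,\dots,d\}$ is a surjective proper edge-coloring (adjacent edges get different colors). $\Gamma$ embeds regularly on a surface $S$ if it can be cellularly embedded in $S$ so that every face is bounded by a bi-colored cycle using two consecutive colors $\varepsilon_i,\varepsilon_{i+1}$ (indices mod $d+1$) of a fixed cyclic permutation $\varepsilon$ of $\Delta_d$; without loss of generality $\varepsilon=(0,1,\dots,d)$. Then at each vertex $x$ the incident faces, in cyclic order, are $P_0,P_1,\dots,P_d$, where $P_i$ is bounded by the $\{i,i+1\}$-colored cycle through $x$ (colors mod $d+1$); each face is a polygon with an even number of sides. Only embeddings in which every face has at least $4$ sides are considered. $\Gamma$ is a semi-equivelar graph embedded regularly on $S$ if the cyclic sequence of face lengths $(|P_0|,\dots,|P_d|)$ is the same (of the same type) at every vertex. If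 this sequence consists of $n_0$ consecutive $p_0$-gons, then $n_1$ consecutive $p_1$-gons, ..., $n_m$ consecutive $p_m$-gons, and $\Gamma$ has $p$ vertices, $\Gamma$ is said to be of type $[(p_0^{n_0},p_1^{n_1},\dots,p_m^{n_m});p]$ (exponent $1$ omitted; the sequence is considered cyclically). -}

module Defs where

open import Data.Nat using (ℕ; zero; suc; _+_; _*_; _≤_; _<_; _≤ᵇ_; _/_)
open import Data.Nat.DivMod using (_%_; m%n<n)
open import Data.Fin using (Fin; toℕ; fromℕ<; _≟_)
open import Data.List using (List; []; _∷_; _++_; map; length; filterᵇ; allFin; upTo; concatMap; take; drop; reverse)
open import Data.Bool using (Bool)
open import Data.Bool.ListAction using (all)
open import Data.Nat.ListAction using (sum)
open import Data.Integer as ℤ using (ℤ; +_; -[1+_])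
open import Data.Product using (Σ; ∃; _×_; _,_)
open import Data.Sum using (_⊎_)
open import Relation.Nullary using (¬_; yes; no)
open import Relation.Binary.PropositionalEquality using (_≡_; _≢_)

-- Colors Δ_d = {0,…,d} are Fin (suc d); the cyclic successor i ↦ i+1 mod (d+1)
-- (this is the fixed cyclic permutation ε = (0,1,…,d)).
next : {d : ℕ} → Fin (suc d) → Fin (suc d)
next {d} i = fromℕ< (m%n<n (suc (toℕ i)) (suc d))

-- A (d+1)-regular properly (d+1)-edge-colored finite multigraph without loops
-- on the vertex set Fin p.  Regularity + properness means: each vertex has
-- exactly one incident edge of each color c; σ c x is the other end of it.
-- Multiple edges are allowed (σ c x ≡ σ c' x possible).  Surjectivity of
-- the coloring amounts to Γ being nonempty.
record ColoredGraph (d p : ℕ) : Set where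
  field
    σ        : Fin (suc d) → Fin p → Fin p
    invol    : ∀ c x → σ c (σ c x) ≡ x
    noLoop   : ∀ c x → σ c x ≢ x
    nonempty : 0 < p
open ColoredGraph public

data Reach {d p : ℕ} (G : ColoredGraph d p) : Fin p → Fin p → Set where
  here : ∀ x → Reach G x x
  step : ∀ {x y} (c : Fin (suc d)) → Reach G (σ G c x) y → Reach G x y

Connected : {d p : ℕ} → ColoredGraph d p → Set
Connected {d} {p} G = ∀ (x y : Fin p) → Reach G x y

iter : {A : Set} → (A → A) → ℕ → A → A
iter f zero    x = x
iter f (suc n) x = f (iter f n x)

-- least k ≥ 1 (searched among 1..fuel) with f^k x ≡ x  (0 if none)
returnAux : {p : ℕ} → (Fin p → Fin p) → Fin p → Fin p → ℕ → ℕ → ℕ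
returnAux f x y k zero    = 0
returnAux f x y k (suc n) with f y ≟ x
... | yes _ = suc k
... | no  _ = returnAux f x (f y) (suc k) n

returnTime : {p : ℕ} → (Fin p → Fin p) → Fin p → ℕ
returnTime {p} f x = returnAux f x x 0 p

module _ {d p : ℕ} (G : ColoredGraph d p) where

  alt : Fin (suc d) → Fin p → Fin p
  alt i x = σ G (next i) (σ G i x)

  -- number of sides |P_i| of the face P_i at x, i.e. the length of the
  -- {i,i+1}-colored cycle through x
  faceSides : Fin (suc d) → Fin p → ℕ
  faceSides i x = 2 * returnTime (alt i) x

  cycleVerts : Fin (suc d) → Fin p → List (Fin p)
  cycleVerts i x =
    concatMap (λ j → iter (alt i) j x ∷ σ G i (iter (alt i) j x) ∷ [])
              (upTo (returnTime (alt i) x))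

  isRep : Fin (suc d) → Fin p → Bool
  isRep i x = all (λ y → toℕ x ≤ᵇ toℕ y) (cycleVerts i x)

  numFaces : Fin (suc d) → ℕ
  numFaces i = length (filterᵇ (isRep i) (allFin p))

  V E F : ℕ
  V = p
  E = suc d * (p / 2)
  F = sum (map numFaces (allFin (suc d)))

  euler : ℤ
  euler = (+ V) ℤ.- (+ E) ℤ.+ (+ F)

  faceSeq : Fin p → List ℕ
  faceSeq x = map (λ i → faceSides i x) (allFin (suc d))

rotate : {A : Set} → ℕ → List A → List A
rotate k l = drop k l ++ take k l

CycEq : List ℕ → List ℕ → Set
CycEq s t = ∃ λ k → (s ≡ rotate k t) ⊎ (s ≡ rotate k (reverse t))

module _ {d p : ℕ} (G : ColoredGraph d p) where

  AllFacesAtLeast4 : Set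
  AllFacesAtLeast4 = ∀ i x → 4 ≤ faceSides G i x

  SemiEquivelar : Set
  SemiEquivelar = ∀ x y → CycEq (faceSeq G x) (faceSeq G y)

  OfType : List ℕ → ℕ → Set
  OfType s q = (p ≡ q) × (∀ x → CycEq (faceSeq G x) s)

typeList : List (List ℕ × ℕ)
typeList =
    (4 ∷ 4 ∷ 4 ∷ 4 ∷ 4 ∷ [] , 4)
  ∷ (4 ∷ 4 ∷ 4 ∷ 8 ∷ [] , 8)
  ∷ (4 ∷ 4 ∷ 4 ∷ 6 ∷ [] , 12)
  ∷ (8 ∷ 8 ∷ 8 ∷ [] , 8)
  ∷ (6 ∷ 6 ∷ 8 ∷ [] , 24)
  ∷ (6 ∷ 6 ∷ 12 ∷ [] , 12)
  ∷ (10 ∷ 10 ∷ 4 ∷ [] , 20)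
  ∷ (12 ∷ 12 ∷ 4 ∷ [] , 12)
  ∷ (4 ∷ 6 ∷ 14 ∷ [] , 84)
  ∷ (4 ∷ 6 ∷ 16 ∷ [] , 48)
  ∷ (4 ∷ 6 ∷ 18 ∷ [] , 36)
  ∷ (4 ∷ 6 ∷ 24 ∷ [] , 24)
  ∷ (4 ∷ 8 ∷ 10 ∷ [] , 40)
  ∷ (4 ∷ 8 ∷ 12 ∷ [] , 24)
  ∷ (4 ∷ 8 ∷ 16 ∷ [] , 16)
  ∷ []

-- The {i,i+1}-coloured faces are the orbits of the alternating walk α = σ_{i+1} ∘ σ_i
-- (together with their σ_i-images), so they partition the p vertices, a face with q sides
-- containing q of them.  Counting incidences colour by colour gives F = p ∑ 1/v over the
-- face sizes v around one vertex, and V - E + F = -1 becomes ∑ 1/v = (d - 1)/2 - 1/p.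
-- Since every v ≥ 4 this forces d + 1 ≤ 5 and v ≤ 24, 8, 4 for d + 1 = 3, 4, 5, so the
-- solutions are found by a finite search that also uses v ≤ p and v ∣ p · (multiplicity
-- of v).  Two survivors, (6,8,8) with p = 12 and (4,4,6,6) with p = 6, are not realised:
-- a colour whose faces have two sizes splits the p vertices into multiples of those sizes.
-- The remaining face multisets can be arranged cyclically in only one way up to reflection.

module Submission where

open import Defs
open import Data.Nat using (ℕ; suc; _≤_)
open import Data.Integer using (-[1+_])
open import Data.List.Membership.Propositional using (_∈_)
open import Data.Product using (∃; _×_; _,_)
open import Relation.Binary.PropositionalEquality using (_≡_; trans)
open import Data.Fin using (Fin; zero; fromℕ<)
open import Data.Nat.Properties using (*-comm)
open import Data.Nat.Divisibility using (divides)

module FiniteSum where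
  open import Data.Nat using (ℕ; zero; suc; _+_; _*_; _≤_)
  open import Data.Nat.Properties using (+-*-semiring; m≤m+n; m≤n+m; ≤-trans; *-zeroʳ)
  open import Data.Nat.Divisibility using (_∣_; divides; _∣0; ∣m∣n⇒∣m+n)
  open import Data.Nat.DivMod using (_/_; m/n*n≡m)
  open import Data.Fin using (Fin; zero; suc; _≟_)
  open import Data.Bool using (Bool; true; false; T)
  open import Data.List using (List; []; _∷_; map; length; filterᵇ; allFin; tabulate)
  import Data.Nat.ListAction as List
  open import Relation.Nullary using (Dec; yes; no; ¬_)
  open import Relation.Nullary.Decidable using (map′)
  open import Relation.Binary.PropositionalEquality
  open import Data.Empty using (⊥-elim)

  open import Algebra.Properties.Semiring.Sum +-*-semiring public

  𝟙 : ∀ {a} {A : Set a} → Dec A → ℕ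
  𝟙 (yes _) = 1
  𝟙 (no _)  = 0

  𝟙-yes : ∀ {a} {A : Set a} (A? : Dec A) → A → 𝟙 A? ≡ 1
  𝟙-yes (yes _) _ = refl
  𝟙-yes (no ¬a) a = ⊥-elim (¬a a)

  𝟙-no : ∀ {a} {A : Set a} (A? : Dec A) → ¬ A → 𝟙 A? ≡ 0
  𝟙-no (yes a) ¬a = ⊥-elim (¬a a)
  𝟙-no (no _)  _  = refl

  𝟙ᵇ : Bool → ℕ
  𝟙ᵇ true  = 1
  𝟙ᵇ false = 0

  ∑-const : ∀ n c → ∑[ i < n ] c ≡ n * c
  ∑-const zero    c = refl
  ∑-const (suc n) c = cong (c +_) (∑-const n c)

  ∑-𝟙-≟ : ∀ {n} (z : Fin n) → ∑[ y < n ] 𝟙 (y ≟ z) ≡ 1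
  ∑-𝟙-≟ {suc n} zero = cong suc (trans (sum-cong-≗ {n} (λ y → 𝟙-no (suc y ≟ zero) λ ())) (sum-replicate-zero n))
  ∑-𝟙-≟ {suc n} (suc z) =
    trans (sum-cong-≗ {n} (λ y → 𝟙-map (y ≟ z))) (∑-𝟙-≟ z)
    where
    𝟙-map : ∀ {a b} {A : Set a} {B : Set b} {f : A → B} {g : B → A} (A? : Dec A) → 𝟙 (map′ f g A?) ≡ 𝟙 A?
    𝟙-map (yes _) = refl
    𝟙-map (no _)  = refl

  term≤∑ : ∀ {n} (f : Fin n → ℕ) i → f i ≤ ∑[ j < n ] f j
  term≤∑ f zero    = m≤m+n _ _
  term≤∑ f (suc i) = ≤-trans (term≤∑ (λ j → f (suc j)) i) (m≤n+m _ (f zero))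

  ∣-∑ : ∀ {n} q (f : Fin n → ℕ) → (∀ i → q ∣ f i) → q ∣ ∑[ i < n ] f i
  ∣-∑ {zero}  q f q∣f = q ∣0
  ∣-∑ {suc n} q f q∣f = ∣m∣n⇒∣m+n (q∣f zero) (∣-∑ q (λ i → f (suc i)) (λ i → q∣f (suc i)))

  sum-map-allFin : ∀ n (f : Fin n → ℕ) → List.sum (map f (allFin n)) ≡ ∑[ i < n ] f i
  sum-map-allFin n f = sum-map-tabulate (λ i → i)
    where
    sum-map-tabulate : ∀ {m} (g : Fin m → Fin n) → List.sum (map f (tabulate g)) ≡ ∑[ i < m ] f (g i)
    sum-map-tabulate {zero}  g = refl
    sum-map-tabulate {suc m} g = cong (f (g zero) +_) (sum-map-tabulate (λ i → g (suc i)))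

  length-filterᵇ-allFin : ∀ n (b : Fin n → Bool) → length (filterᵇ b (allFin n)) ≡ ∑[ i < n ] 𝟙ᵇ (b i)
  length-filterᵇ-allFin n b = trans (length-filterᵇ (allFin n)) (sum-map-allFin n (λ i → 𝟙ᵇ (b i)))
    where
    length-filterᵇ : ∀ xs → length (filterᵇ b xs) ≡ List.sum (map (λ i → 𝟙ᵇ (b i)) xs)
    length-filterᵇ [] = refl
    length-filterᵇ (x ∷ xs) with b x
    ... | true  = cong suc (length-filterᵇ xs)
    ... | false = length-filterᵇ xs

  𝟙ᵇ-T : ∀ {b} → T b → 𝟙ᵇ b ≡ 1
  𝟙ᵇ-T {true} _ = refl

  -- Division made total by m ÷ 0 = 0; it is only ever applied to nonzero divisors.
  _÷_ : ℕ → ℕ → ℕ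
  m ÷ zero  = 0
  m ÷ suc n = m / suc n

  ÷-* : ∀ {m n} → n ∣ m → m ÷ n * n ≡ m
  ÷-* {m} {zero}  (divides q refl) = sym (*-zeroʳ q)
  ÷-* {m} {suc n} n∣m = m/n*n≡m n∣m

module Iterate where
  open import Defs using (iter; returnAux; returnTime)
  open import Data.Nat using (ℕ; zero; suc; _+_; _*_; _<_; _≤_; NonZero)
  open import Data.Nat.Properties hiding (_≟_)
  open import Data.Nat.Properties using () renaming (_≟_ to _≟ℕ_)
  open import Data.Nat.DivMod using (_%_; _/_; m≡m%n+[m/n]*n)
  open import Data.Fin using (Fin; _≟_)
  open import Data.Product using (_×_; _,_; proj₁; proj₂)
  open import Data.Empty using (⊥-elim)
  open import Relation.Nullary using (yes; no)
  open import Relation.Binary.PropositionalEquality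

  module _ {A : Set} (f : A → A) where

    iter-+ : ∀ m n x → iter f (m + n) x ≡ iter f m (iter f n x)
    iter-+ zero    n x = refl
    iter-+ (suc m) n x = cong f (iter-+ m n x)

    iter-comm : ∀ m n x → iter f m (iter f n x) ≡ iter f n (iter f m x)
    iter-comm m n x = begin
      iter f m (iter f n x) ≡⟨ iter-+ m n x ⟨
      iter f (m + n) x      ≡⟨ cong (λ k → iter f k x) (+-comm m n) ⟩
      iter f (n + m) x      ≡⟨ iter-+ n m x ⟩
      iter f n (iter f m x) ∎
      where open ≡-Reasoning

    iter-injective : (∀ {x y} → f x ≡ f y → x ≡ y) → ∀ n {x y} → iter f n x ≡ iter f n y → x ≡ y
    iter-injective f-inj zero    eq = eq
    iter-injective f-inj (suc n) eq = iter-injective f-inj n (f-inj eq)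

    module _ {x : A} {r : ℕ} (period : iter f r x ≡ x) where

      iter-*-period : ∀ k → iter f (k * r) x ≡ x
      iter-*-period zero    = refl
      iter-*-period (suc k) = trans (iter-+ r (k * r) x) (trans (cong (iter f r) (iter-*-period k)) period)

      iter-+-*-period : ∀ j k → iter f (j + k * r) x ≡ iter f j x
      iter-+-*-period j k = trans (iter-+ j (k * r) x) (cong (iter f j) (iter-*-period k))

      iter-% : .{{_ : NonZero r}} → ∀ j → iter f j x ≡ iter f (j % r) x
      iter-% j = trans (cong (λ m → iter f m x) (m≡m%n+[m/n]*n j r)) (iter-+-*-period (j % r) (j / r))

  module _ {p : ℕ} (f : Fin p → Fin p) where

    private
      returnAux-spec : ∀ x y k n m → y ≡ iter f k x → returnAux f x y k n ≡ suc m →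
                       iter f (suc m) x ≡ x × (∀ j → k < j → j ≤ m → iter f j x ≢ x)
      returnAux-spec x y k (suc n) m y≡ eq with f y ≟ x
      returnAux-spec x y k (suc n) m y≡ refl | yes fy≡x =
        trans (cong f (sym y≡)) fy≡x , λ j k<j j≤k → ⊥-elim (<-irrefl refl (<-≤-trans k<j j≤k))
      ... | no fy≢x with returnAux-spec x (f y) (suc k) n m (cong f y≡) eq
      ...   | returns , minimal = returns , minimal′
        where
        minimal′ : ∀ j → k < j → j ≤ m → iter f j x ≢ x
        minimal′ j k<j j≤m with suc k ≟ℕ j
        ... | yes refl = λ eq′ → fy≢x (trans (cong f y≡) eq′)
        ... | no  k+1≢j = minimal j (≤∧≢⇒< k<j k+1≢j) j≤m

    iter-returnTime : ∀ x → 0 < returnTime f x → iter f (returnTime f x) x ≡ x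
    iter-returnTime x 0<r with returnTime f x in eq
    ... | suc m = proj₁ (returnAux-spec x x 0 p m refl eq)

    returnTime-minimal : ∀ x j → 0 < j → j < returnTime f x → iter f j x ≢ x
    returnTime-minimal x j 0<j j<r with returnTime f x in eq
    ... | suc m = proj₂ (returnAux-spec x x 0 p m refl eq) j 0<j (≤-pred j<r)

module Faces {d p : ℕ} (G : ColoredGraph d p) (i : Fin (suc d))
             (sides≥4 : ∀ x → 4 ≤ faceSides G i x) where

  open import Defs
  open FiniteSum
  open Iterate
  open import Data.Nat using (ℕ; zero; suc; pred; _+_; _*_; _∸_; _<_; _≤_; s≤s; z≤n; NonZero; >-nonZero; _≤ᵇ_)
  open import Data.Nat.Properties hiding (_≟_)
  open import Data.Nat.Properties using () renaming (_≟_ to _≟ℕ_)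
  open import Data.Nat.DivMod using (_%_; m%n<n)
  open import Data.Nat.Divisibility using (_∣_; ∣n⇒∣m*n; m∣m*n; ∣-refl; _∣0)
  open import Data.Fin using (Fin; toℕ; _≟_)
  open import Data.Fin.Properties using (toℕ-injective)
  open import Data.Bool using (true; false; T)
  open import Data.List using (List; []; _∷_; upTo)
  open import Data.List.Membership.Propositional using (_∈_; _∉_; find)
  open import Data.List.Relation.Unary.Any as Any using (here; there)
  import Data.List.Relation.Unary.All as All
  open import Data.List.Relation.Unary.All.Properties using (all⁺; all⁻)
  open import Data.List.Membership.Propositional.Properties using (∈-concatMap⁺; ∈-concatMap⁻; ∈-upTo⁺)
  open import Data.List.Extrema ≤-totalOrder using (argmin; argmin-all; f[argmin]≤f[xs])
  open import Data.Product using (∃; _×_; _,_)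
  open import Data.Sum using (_⊎_; inj₁; inj₂)
  open import Data.Empty using (⊥-elim)
  open import Relation.Nullary using (yes; no)
  open import Relation.Binary.Definitions using (tri<; tri≈; tri>)
  open import Relation.Binary.PropositionalEquality

  open import Data.List.Membership.DecPropositional (_≟_ {p}) using (_∈?_)

  σᵢ σᵢ₊₁ α : Fin p → Fin p
  σᵢ   = σ G i
  σᵢ₊₁ = σ G (next i)
  α    = alt G i

  involution-injective : ∀ c {x y} → σ G c x ≡ σ G c y → x ≡ y
  involution-injective c {x} {y} eq = trans (sym (invol G c x)) (trans (cong (σ G c) eq) (invol G c y))

  α^ : ℕ → Fin p → Fin p
  α^ = iter α

  α^-injective : ∀ n {x y} → α^ n x ≡ α^ n y → x ≡ y
  α^-injective = iter-injective α (λ eq → involution-injective i (involution-injective (next i) eq))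

  ρ : Fin p → ℕ
  ρ = returnTime α

  2≤ρ : ∀ x → 2 ≤ ρ x
  2≤ρ x = *-cancelˡ-≤ 2 (sides≥4 x)

  instance
    ρ-nonZero : ∀ {x} → NonZero (ρ x)
    ρ-nonZero {x} = >-nonZero (<-≤-trans (s≤s z≤n) (2≤ρ x))

  α^ρ : ∀ x → α^ (ρ x) x ≡ x
  α^ρ x = iter-returnTime α x (<-≤-trans (s≤s z≤n) (2≤ρ x))

  -- α^ (k * ρ⁻ x) inverts α^ k on the face of x.
  ρ⁻ : Fin p → ℕ
  ρ⁻ x = pred (ρ x)

  private
    k*ρ⁻+k : ∀ x k → k * ρ⁻ x + k ≡ k * ρ x
    k*ρ⁻+k x k = begin
      k * ρ⁻ x + k     ≡⟨ +-comm (k * ρ⁻ x) k ⟩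
      k + k * ρ⁻ x     ≡⟨ *-suc k (ρ⁻ x) ⟨
      k * suc (ρ⁻ x)   ≡⟨ cong (k *_) (suc-pred (ρ x)) ⟩
      k * ρ x          ∎
      where open ≡-Reasoning

  α^-shift : ∀ x j k → α^ (j + k * ρ⁻ x + k) x ≡ α^ j x
  α^-shift x j k = begin
    α^ (j + k * ρ⁻ x + k) x    ≡⟨ cong (λ t → α^ t x) (+-assoc j (k * ρ⁻ x) k) ⟩
    α^ (j + (k * ρ⁻ x + k)) x  ≡⟨ cong (λ t → α^ (j + t) x) (k*ρ⁻+k x k) ⟩
    α^ (j + k * ρ x) x         ≡⟨ iter-+-*-period α (α^ρ x) j k ⟩
    α^ j x                     ∎
    where open ≡-Reasoning

  α^-cancel : ∀ x j k → α^ k (α^ (j + k * ρ⁻ x) x) ≡ α^ j x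
  α^-cancel x j k = begin
    α^ k (α^ (j + k * ρ⁻ x) x)  ≡⟨ iter-comm α k (j + k * ρ⁻ x) x ⟩
    α^ (j + k * ρ⁻ x) (α^ k x)  ≡⟨ iter-+ α (j + k * ρ⁻ x) k x ⟨
    α^ (j + k * ρ⁻ x + k) x     ≡⟨ α^-shift x j k ⟩
    α^ j x                      ∎
    where open ≡-Reasoning

  -- σᵢ conjugates α into its inverse: α (σᵢ y) = σᵢ (α⁻¹ y).
  α^-σᵢ : ∀ k m z → α^ k (σᵢ (α^ (m + k) z)) ≡ σᵢ (α^ m z)
  α^-σᵢ zero    m z = cong (λ t → σᵢ (α^ t z)) (+-identityʳ m)
  α^-σᵢ (suc k) m z = begin
    α (α^ k (σᵢ (α^ (m + suc k) z)))  ≡⟨ cong (λ t → α (α^ k (σᵢ (α^ t z)))) (+-suc m k) ⟩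
    α (α^ k (σᵢ (α^ (suc m + k) z)))  ≡⟨ cong α (α^-σᵢ k (suc m) z) ⟩
    σᵢ₊₁ (σᵢ (σᵢ (σᵢ₊₁ (σᵢ (α^ m z))))) ≡⟨ cong σᵢ₊₁ (invol G i _) ⟩
    σᵢ₊₁ (σᵢ₊₁ (σᵢ (α^ m z)))          ≡⟨ invol G (next i) _ ⟩
    σᵢ (α^ m z)                        ∎
    where open ≡-Reasoning

  α^-σᵢ-α^ : ∀ x j k → α^ k (σᵢ (α^ j x)) ≡ σᵢ (α^ (j + k * ρ⁻ x) x)
  α^-σᵢ-α^ x j k = begin
    α^ k (σᵢ (α^ j x))                        ≡⟨ cong (λ t → α^ k (σᵢ t)) (α^-shift x j k) ⟨
    α^ k (σᵢ (α^ (j + k * ρ⁻ x + k) x))        ≡⟨ α^-σᵢ k (j + k * ρ⁻ x) x ⟩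
    σᵢ (α^ (j + k * ρ⁻ x) x)                  ∎
    where open ≡-Reasoning

  SameFace : Fin p → Fin p → Set
  SameFace x y = ∃ λ j → y ≡ α^ j x ⊎ y ≡ σᵢ (α^ j x)

  sameFace-refl : ∀ x → SameFace x x
  sameFace-refl x = 0 , inj₁ refl

  sameFace-sym : ∀ {x y} → SameFace x y → SameFace y x
  sameFace-sym {x} (j , inj₁ refl) = j * ρ⁻ x , inj₁ (begin
    x                          ≡⟨ α^-shift x 0 j ⟨
    α^ (j * ρ⁻ x + j) x        ≡⟨ iter-+ α (j * ρ⁻ x) j x ⟩
    α^ (j * ρ⁻ x) (α^ j x)     ∎)
    where open ≡-Reasoning
  sameFace-sym {x} (j , inj₂ refl) = j , inj₂ (begin
    x                              ≡⟨ α^-shift x 0 j ⟨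
    α^ (j * ρ⁻ x + j) x            ≡⟨ cong (λ t → α^ t x) (+-comm (j * ρ⁻ x) j) ⟩
    α^ (j + j * ρ⁻ x) x            ≡⟨ invol G i _ ⟨
    σᵢ (σᵢ (α^ (j + j * ρ⁻ x) x))  ≡⟨ cong σᵢ (α^-σᵢ-α^ x j j) ⟨
    σᵢ (α^ j (σᵢ (α^ j x)))        ∎)
    where open ≡-Reasoning

  sameFace-trans : ∀ {x y z} → SameFace x y → SameFace y z → SameFace x z
  sameFace-trans {x} (j , inj₁ refl) (k , inj₁ refl) = k + j , inj₁ (sym (iter-+ α k j x))
  sameFace-trans {x} (j , inj₁ refl) (k , inj₂ refl) = k + j , inj₂ (cong σᵢ (sym (iter-+ α k j x)))
  sameFace-trans {x} (j , inj₂ refl) (k , inj₁ refl) = j + k * ρ⁻ x , inj₂ (α^-σᵢ-α^ x j k)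
  sameFace-trans {x} (j , inj₂ refl) (k , inj₂ refl) =
    j + k * ρ⁻ x , inj₁ (trans (cong σᵢ (α^-σᵢ-α^ x j k)) (invol G i _))

  sameFace-period : ∀ {x y} → SameFace x y → ∀ k → α^ k y ≡ y → α^ k x ≡ x
  sameFace-period {x} (j , inj₁ refl) k αᵏy≡y = α^-injective j (trans (iter-comm α j k x) αᵏy≡y)
  sameFace-period {x} (j , inj₂ refl) k αᵏy≡y =
    α^-injective j (trans (iter-comm α j k x) (trans (cong (α^ k) (sym shifted)) (α^-cancel x j k)))
    where
    shifted : α^ (j + k * ρ⁻ x) x ≡ α^ j x
    shifted = involution-injective i (trans (sym (α^-σᵢ-α^ x j k)) αᵏy≡y)

  ρ-≤ : ∀ {x y} → SameFace x y → ρ x ≤ ρ y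
  ρ-≤ {x} {y} x~y with <-cmp (ρ y) (ρ x)
  ... | tri< ρy<ρx _ _ = ⊥-elim (returnTime-minimal α x (ρ y) (<-≤-trans (s≤s z≤n) (2≤ρ y)) ρy<ρx
                                   (sameFace-period x~y (ρ y) (α^ρ y)))
  ... | tri≈ _ ρy≡ρx _ = ≤-reflexive (sym ρy≡ρx)
  ... | tri> _ _ ρx<ρy = <⇒≤ ρx<ρy

  ρ-sameFace : ∀ {x y} → SameFace x y → ρ y ≡ ρ x
  ρ-sameFace x~y = ≤-antisym (ρ-≤ (sameFace-sym x~y)) (ρ-≤ x~y)

  faceSides-sameFace : ∀ {x y} → SameFace x y → faceSides G i y ≡ faceSides G i x
  faceSides-sameFace x~y = cong (2 *_) (ρ-sameFace x~y)

  private
    even-or-odd : ∀ t → ∃ λ u → t ≡ u + u ⊎ t ≡ suc (u + u)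
    even-or-odd zero = 0 , inj₁ refl
    even-or-odd (suc t) with even-or-odd t
    ... | u , inj₁ t≡2u   = u , inj₂ (cong suc t≡2u)
    ... | u , inj₂ t≡2u+1 = suc u , inj₁ (cong suc (trans t≡2u+1 (sym (+-suc u u))))

  α^-injectiveₙ : ∀ x j k → j < k → k < ρ x → α^ j x ≢ α^ k x
  α^-injectiveₙ x j k j<k k<ρ eq =
    returnTime-minimal α x (k ∸ j) (m<n⇒0<n∸m j<k) (≤-<-trans (m∸n≤m k j) k<ρ) (α^-injective j (begin
      α^ j (α^ (k ∸ j) x)  ≡⟨ iter-+ α j (k ∸ j) x ⟨
      α^ (j + (k ∸ j)) x   ≡⟨ cong (λ t → α^ t x) (m+[n∸m]≡n (<⇒≤ j<k)) ⟩
      α^ k x               ≡⟨ eq ⟨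
      α^ j x               ∎))
    where open ≡-Reasoning

  -- An even t would give a loop of colour i, an odd one a loop of colour i+1.
  α^≢σᵢ : ∀ t z → α^ t z ≢ σᵢ z
  α^≢σᵢ t z eq with even-or-odd t
  ... | u , inj₁ t≡2u = noLoop G i (α^ u z) (α^-injective u (begin
      α^ u (σᵢ (α^ u z))  ≡⟨ α^-σᵢ u 0 z ⟩
      σᵢ z                ≡⟨ eq ⟨
      α^ t z              ≡⟨ cong (λ s → α^ s z) t≡2u ⟩
      α^ (u + u) z        ≡⟨ iter-+ α u u z ⟩
      α^ u (α^ u z)       ∎))
    where open ≡-Reasoning
  ... | u , inj₂ t≡2u+1 = noLoop G (next i) (σᵢ (α^ u z)) (sym (α^-injective u (begin
      α^ u (σᵢ (α^ u z))  ≡⟨ α^-σᵢ u 0 z ⟩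
      σᵢ z                ≡⟨ eq ⟨
      α^ t z              ≡⟨ cong (λ s → α^ s z) (trans t≡2u+1 (sym (+-suc u u))) ⟩
      α^ (u + suc u) z    ≡⟨ iter-+ α u (suc u) z ⟩
      α^ u (α^ (suc u) z) ∎)))
    where open ≡-Reasoning

  α^≢σᵢ-α^ : ∀ x j k → α^ j x ≢ σᵢ (α^ k x)
  α^≢σᵢ-α^ x j k eq = α^≢σᵢ (j + k * ρ⁻ x) (α^ k x)
    (trans (iter-comm α (j + k * ρ⁻ x) k x) (trans (α^-cancel x j k) eq))

  faceList : Fin p → ℕ → List (Fin p)
  faceList x zero    = []
  faceList x (suc n) = α^ n x ∷ σᵢ (α^ n x) ∷ faceList x n

  ∈-faceList⁻ : ∀ x n {y} → y ∈ faceList x n → ∃ λ j → j < n × (y ≡ α^ j x ⊎ y ≡ σᵢ (α^ j x))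
  ∈-faceList⁻ x (suc n) (here y≡)         = n , ≤-refl , inj₁ y≡
  ∈-faceList⁻ x (suc n) (there (here y≡)) = n , ≤-refl , inj₂ y≡
  ∈-faceList⁻ x (suc n) (there (there y∈)) with ∈-faceList⁻ x n y∈
  ... | j , j<n , y≡ = j , m≤n⇒m≤1+n j<n , y≡

  ∈-faceList⁺ : ∀ x n j {y} → j < n → y ≡ α^ j x ⊎ y ≡ σᵢ (α^ j x) → y ∈ faceList x n
  ∈-faceList⁺ x (suc n) j j<n y≡ with j ≟ℕ n
  ∈-faceList⁺ x (suc n) j j<n (inj₁ y≡) | yes refl = here y≡
  ∈-faceList⁺ x (suc n) j j<n (inj₂ y≡) | yes refl = there (here y≡)
  ... | no j≢n = there (there (∈-faceList⁺ x n j (≤∧≢⇒< (≤-pred j<n) j≢n) y≡))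

  sameFace⇒∈faceList : ∀ {x y} → SameFace x y → y ∈ faceList x (ρ x)
  sameFace⇒∈faceList {x} (j , inj₁ y≡) =
    ∈-faceList⁺ x (ρ x) (j % ρ x) (m%n<n j (ρ x)) (inj₁ (trans y≡ (iter-% α (α^ρ x) j)))
  sameFace⇒∈faceList {x} (j , inj₂ y≡) =
    ∈-faceList⁺ x (ρ x) (j % ρ x) (m%n<n j (ρ x)) (inj₂ (trans y≡ (cong σᵢ (iter-% α (α^ρ x) j))))

  ∈faceList⇒sameFace : ∀ {x y} n → y ∈ faceList x n → SameFace x y
  ∈faceList⇒sameFace {x} n y∈ with ∈-faceList⁻ x n y∈
  ... | j , _ , y≡ = j , y≡

  private
    𝟙-∈?-∷ : ∀ y {z : Fin p} {L : List (Fin p)} → z ∉ L → 𝟙 (y ∈? z ∷ L) ≡ 𝟙 (y ≟ z) + 𝟙 (y ∈? L)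
    𝟙-∈?-∷ y {z} {L} z∉L with y ≟ z | y ∈? L
    ... | yes y≡z  | yes y∈L = ⊥-elim (z∉L (subst (_∈ L) y≡z y∈L))
    ... | yes _    | no _    = refl
    ... | no _     | yes _   = refl
    ... | no _     | no _    = refl

  ∑-𝟙-∈faceList : ∀ x n → n ≤ ρ x → ∑[ y < p ] 𝟙 (y ∈? faceList x n) ≡ 2 * n
  ∑-𝟙-∈faceList x zero    _   = sum-replicate-zero p
  ∑-𝟙-∈faceList x (suc n) n<ρ = begin
    ∑[ y < p ] 𝟙 (y ∈? v ∷ w ∷ L)
      ≡⟨ sum-cong-≗ {p} (λ y → trans (𝟙-∈?-∷ y v∉w∷L) (cong (𝟙 (y ≟ v) +_) (𝟙-∈?-∷ y w∉L))) ⟩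
    ∑[ y < p ] (𝟙 (y ≟ v) + (𝟙 (y ≟ w) + 𝟙 (y ∈? L)))
      ≡⟨ ∑-distrib-+ (λ y → 𝟙 (y ≟ v)) _ ⟩
    ∑[ y < p ] 𝟙 (y ≟ v) + ∑[ y < p ] (𝟙 (y ≟ w) + 𝟙 (y ∈? L))
      ≡⟨ cong₂ _+_ (∑-𝟙-≟ v) (∑-distrib-+ (λ y → 𝟙 (y ≟ w)) _) ⟩
    1 + (∑[ y < p ] 𝟙 (y ≟ w) + ∑[ y < p ] 𝟙 (y ∈? L))
      ≡⟨ cong₂ (λ a b → 1 + (a + b)) (∑-𝟙-≟ w) (∑-𝟙-∈faceList x n (<⇒≤ n<ρ)) ⟩
    2 + 2 * n
      ≡⟨ *-suc 2 n ⟨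
    2 * suc n ∎
    where
    open ≡-Reasoning
    v = α^ n x
    w = σᵢ (α^ n x)
    L = faceList x n
    v∉L : v ∉ L
    v∉L v∈L with ∈-faceList⁻ x n v∈L
    ... | j , j<n , inj₁ v≡ = α^-injectiveₙ x j n j<n n<ρ (sym v≡)
    ... | j , j<n , inj₂ v≡ = α^≢σᵢ-α^ x n j v≡
    w∉L : w ∉ L
    w∉L w∈L with ∈-faceList⁻ x n w∈L
    ... | j , j<n , inj₁ w≡ = α^≢σᵢ-α^ x j n (sym w≡)
    ... | j , j<n , inj₂ w≡ = α^-injectiveₙ x j n j<n n<ρ (sym (involution-injective i w≡))
    v∉w∷L : v ∉ w ∷ L
    v∉w∷L (here v≡w) = α^≢σᵢ-α^ x n n v≡w
    v∉w∷L (there v∈L) = v∉L v∈L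

  private
    faceStep : Fin p → ℕ → List (Fin p)
    faceStep x j = α^ j x ∷ σᵢ (α^ j x) ∷ []

  ∈-cycleVerts⁻ : ∀ {x y} → y ∈ cycleVerts G i x → SameFace x y
  ∈-cycleVerts⁻ {x} y∈ with find (∈-concatMap⁻ (faceStep x) {xs = upTo (ρ x)} y∈)
  ... | j , _ , here y≡         = j , inj₁ y≡
  ... | j , _ , there (here y≡) = j , inj₂ y≡

  sameFace⇒∈cycleVerts : ∀ {x y} → SameFace x y → y ∈ cycleVerts G i x
  sameFace⇒∈cycleVerts {x} x~y with ∈-faceList⁻ x (ρ x) (sameFace⇒∈faceList x~y)
  ... | j , j<ρ , inj₁ y≡ = ∈-concatMap⁺ (faceStep x) (Any.map (λ { refl → here y≡ }) (∈-upTo⁺ j<ρ))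
  ... | j , j<ρ , inj₂ y≡ = ∈-concatMap⁺ (faceStep x) (Any.map (λ { refl → there (here y≡) }) (∈-upTo⁺ j<ρ))

  IsLeast : Fin p → Set
  IsLeast x = ∀ y → SameFace x y → toℕ x ≤ toℕ y

  isRep⇒isLeast : ∀ x → T (isRep G i x) → IsLeast x
  isRep⇒isLeast x x-rep y x~y = ≤ᵇ⇒≤ _ _ (All.lookup (all⁺ (λ y → toℕ x ≤ᵇ toℕ y) (cycleVerts G i x) x-rep) (sameFace⇒∈cycleVerts x~y))

  isLeast⇒isRep : ∀ x → IsLeast x → T (isRep G i x)
  isLeast⇒isRep x least = all⁻ (λ y → toℕ x ≤ᵇ toℕ y) (All.tabulate (λ y∈ → ≤⇒≤ᵇ (least _ (∈-cycleVerts⁻ y∈))))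

  rep : Fin p → Fin p
  rep y = argmin toℕ y (faceList y (ρ y))

  sameFace-rep : ∀ y → SameFace (rep y) y
  sameFace-rep y = sameFace-sym (argmin-all toℕ (sameFace-refl y)
                     (All.tabulate (∈faceList⇒sameFace (ρ y))))

  isRep-rep : ∀ y → T (isRep G i (rep y))
  isRep-rep y = isLeast⇒isRep (rep y) λ w m~w →
    All.lookup (f[argmin]≤f[xs] y (faceList y (ρ y)))
               (sameFace⇒∈faceList (sameFace-trans (sameFace-sym (sameFace-rep y)) m~w))

  isRep-unique : ∀ {x x′ y} → T (isRep G i x) → T (isRep G i x′) → SameFace x y → SameFace x′ y → x ≡ x′
  isRep-unique x-rep x′-rep x~y x′~y = toℕ-injective (≤-antisym
    (isRep⇒isLeast _ x-rep  _ (sameFace-trans x~y (sameFace-sym x′~y)))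
    (isRep⇒isLeast _ x′-rep _ (sameFace-trans x′~y (sameFace-sym x~y))))

  private
    inFace : Fin p → Fin p → ℕ
    inFace x y = 𝟙 (y ∈? faceList x (ρ x))

    ∑-rep-inFace : ∀ y → ∑[ x < p ] (𝟙ᵇ (isRep G i x) * inFace x y) ≡ 1
    ∑-rep-inFace y = trans (sum-cong-≗ {p} term) (∑-𝟙-≟ (rep y))
      where
      term : ∀ x → 𝟙ᵇ (isRep G i x) * inFace x y ≡ 𝟙 (x ≟ rep y)
      term x with x ≟ rep y
      ... | yes refl = cong₂ _*_ (𝟙ᵇ-T (isRep-rep y))
                                 (𝟙-yes (y ∈? faceList (rep y) (ρ (rep y))) (sameFace⇒∈faceList (sameFace-rep y)))
      ... | no x≢rep with isRep G i x in x-rep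
      ...   | false = refl
      ...   | true  = cong (1 *_) (𝟙-no (y ∈? faceList x (ρ x)) λ y∈ →
                        x≢rep (isRep-unique (subst T (sym x-rep) _) (isRep-rep y)
                                 (∈faceList⇒sameFace (ρ x) y∈) (sameFace-rep y)))

  ∑-by-faces : (g : Fin p → ℕ) → (∀ {x y} → SameFace x y → g y ≡ g x) →
               ∑[ y < p ] g y ≡ ∑[ x < p ] (𝟙ᵇ (isRep G i x) * (g x * faceSides G i x))
  ∑-by-faces g g-invariant = begin
    ∑[ y < p ] g y
      ≡⟨ sum-cong-≗ {p} (λ y → sym (trans (cong (_* g y) (∑-rep-inFace y)) (+-identityʳ (g y)))) ⟩
    ∑[ y < p ] ((∑[ x < p ] (𝟙ᵇ (isRep G i x) * inFace x y)) * g y)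
      ≡⟨ sum-cong-≗ {p} (λ y → *-distribʳ-sum (g y) (λ x → 𝟙ᵇ (isRep G i x) * inFace x y)) ⟩
    ∑[ y < p ] ∑[ x < p ] (𝟙ᵇ (isRep G i x) * inFace x y * g y)
      ≡⟨ ∑-comm (λ y x → 𝟙ᵇ (isRep G i x) * inFace x y * g y) ⟩
    ∑[ x < p ] ∑[ y < p ] (𝟙ᵇ (isRep G i x) * inFace x y * g y)
      ≡⟨ sum-cong-≗ {p} (λ x → sum-cong-≗ {p} (λ y → on-face x y)) ⟩
    ∑[ x < p ] ∑[ y < p ] (𝟙ᵇ (isRep G i x) * g x * inFace x y)
      ≡⟨ sum-cong-≗ {p} (λ x → sym (*-distribˡ-sum (𝟙ᵇ (isRep G i x) * g x) (inFace x))) ⟩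
    ∑[ x < p ] (𝟙ᵇ (isRep G i x) * g x * ∑[ y < p ] inFace x y)
      ≡⟨ sum-cong-≗ {p} (λ x → trans (cong (𝟙ᵇ (isRep G i x) * g x *_) (∑-𝟙-∈faceList x (ρ x) ≤-refl))
                                      (*-assoc (𝟙ᵇ (isRep G i x)) (g x) _)) ⟩
    ∑[ x < p ] (𝟙ᵇ (isRep G i x) * (g x * faceSides G i x)) ∎
    where
    open ≡-Reasoning
    on-face : ∀ x y → 𝟙ᵇ (isRep G i x) * inFace x y * g y ≡ 𝟙ᵇ (isRep G i x) * g x * inFace x y
    on-face x y with y ∈? faceList x (ρ x)
    ... | yes y∈ rewrite g-invariant (∈faceList⇒sameFace (ρ x) y∈) =
      trans (cong (_* g x) (*-identityʳ (𝟙ᵇ (isRep G i x)))) (sym (*-identityʳ (𝟙ᵇ (isRep G i x) * g x)))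
    ... | no _ = trans (cong (_* g y) (*-zeroʳ (𝟙ᵇ (isRep G i x)))) (sym (*-zeroʳ (𝟙ᵇ (isRep G i x) * g x)))

  private
    p≡∑-rep : p ≡ ∑[ x < p ] (𝟙ᵇ (isRep G i x) * faceSides G i x)
    p≡∑-rep = begin
      p                                                        ≡⟨ trans (∑-const p 1) (*-identityʳ p) ⟨
      ∑[ y < p ] 1                                             ≡⟨ ∑-by-faces (λ _ → 1) (λ _ → refl) ⟩
      ∑[ x < p ] (𝟙ᵇ (isRep G i x) * (1 * faceSides G i x))    ≡⟨ sum-cong-≗ {p} (λ x → cong (𝟙ᵇ (isRep G i x) *_)
                                                                                    (*-identityˡ (faceSides G i x))) ⟩
      ∑[ x < p ] (𝟙ᵇ (isRep G i x) * faceSides G i x)          ∎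
      where open ≡-Reasoning

  2∣p : 2 ∣ p
  2∣p = subst (2 ∣_) (sym p≡∑-rep) (∣-∑ 2 _ (λ x → ∣n⇒∣m*n (𝟙ᵇ (isRep G i x)) (m∣m*n (ρ x))))

  faceSides≤p : ∀ y → faceSides G i y ≤ p
  faceSides≤p y = begin
    faceSides G i y                                  ≡⟨ faceSides-sameFace (sameFace-rep y) ⟩
    faceSides G i x                                  ≡⟨ trans (cong (_* faceSides G i x) (𝟙ᵇ-T (isRep-rep y)))
                                                               (*-identityˡ (faceSides G i x)) ⟨
    𝟙ᵇ (isRep G i x) * faceSides G i x               ≤⟨ term≤∑ (λ x → 𝟙ᵇ (isRep G i x) * faceSides G i x) x ⟩
    ∑[ x < p ] (𝟙ᵇ (isRep G i x) * faceSides G i x)  ≡⟨ p≡∑-rep ⟨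
    p                                                ∎
    where
    open ≤-Reasoning
    x = rep y

  ∣-#faceSides≡ : ∀ q → q ∣ ∑[ y < p ] 𝟙 (faceSides G i y ≟ℕ q)
  ∣-#faceSides≡ q = subst (q ∣_) (sym (∑-by-faces has-q (λ x~y → cong (λ n → 𝟙 (n ≟ℕ q)) (faceSides-sameFace x~y))))
                      (∣-∑ q _ (λ x → ∣n⇒∣m*n (𝟙ᵇ (isRep G i x)) (weighted x)))
    where
    has-q : Fin p → ℕ
    has-q y = 𝟙 (faceSides G i y ≟ℕ q)
    weighted : ∀ x → q ∣ has-q x * faceSides G i x
    weighted x with faceSides G i x ≟ℕ q
    ... | yes refl = ∣n⇒∣m*n 1 ∣-refl
    ... | no _     = q ∣0

  ∑-÷-faceSides : ∀ M → (∀ y → faceSides G i y ∣ M) → ∑[ y < p ] (M ÷ faceSides G i y) ≡ M * numFaces G i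
  ∑-÷-faceSides M fs∣M = begin
    ∑[ y < p ] (M ÷ faceSides G i y)
      ≡⟨ ∑-by-faces (λ y → M ÷ faceSides G i y) (λ x~y → cong (M ÷_) (faceSides-sameFace x~y)) ⟩
    ∑[ x < p ] (𝟙ᵇ (isRep G i x) * (M ÷ faceSides G i x * faceSides G i x))
      ≡⟨ sum-cong-≗ {p} (λ x → cong (𝟙ᵇ (isRep G i x) *_) (÷-* (fs∣M x))) ⟩
    ∑[ x < p ] (𝟙ᵇ (isRep G i x) * M)
      ≡⟨ *-distribʳ-sum M (λ x → 𝟙ᵇ (isRep G i x)) ⟨
    ∑[ x < p ] 𝟙ᵇ (isRep G i x) * M
      ≡⟨ cong (_* M) (length-filterᵇ-allFin p (isRep G i)) ⟨
    numFaces G i * M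
      ≡⟨ *-comm (numFaces G i) M ⟩
    M * numFaces G i ∎
    where open ≡-Reasoning

module CyclicSequences where
  open import Defs using (rotate; CycEq)
  open import Data.Nat using (ℕ; zero; suc)
  open import Data.Nat.Properties using (≤-decTotalOrder; ≤-totalOrder; _≟_)
  open import Data.Bool using (Bool; T; _∨_)
  open import Data.List using (List; []; _∷_; map; concatMap; length; reverse; take; drop; upTo; deduplicate; filter)
  open import Data.Bool.ListAction using (all; any)
  open import Data.List.Properties using (take++drop≡id; ≡-dec)
  open import Data.List.Relation.Binary.Permutation.Propositional using (_↭_; ↭-sym; ↭-trans; ↭-reflexive; ↭⇒↭ₛ)
  open import Data.List.Relation.Binary.Permutation.Propositional.Properties using (++-comm; ↭-reverse; ∈-resp-↭; ↭-length)
  open import Data.List.Relation.Binary.Equality.Propositional using (≋⇒≡)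
  open import Data.List.Relation.Unary.All as All using (All; []; _∷_)
  open import Data.List.Relation.Unary.Any as Any using (here; satisfied)
  open import Data.List.Relation.Unary.All.Properties using (all⁺)
  open import Data.List.Relation.Unary.Any.Properties using (any⁻)
  open import Data.List.Membership.Propositional using (_∈_)
  open import Data.List.Membership.Propositional.Properties using (∈-concatMap⁺; ∈-map⁺; ∈-deduplicate⁺; ∈-filter⁺)
  open import Data.List.Sort.InsertionSort ≤-decTotalOrder using (sort; insertionSort)
  open import Data.List.Sort.Base using (SortingAlgorithm)
  open import Data.List.Relation.Unary.Sorted.TotalOrder.Properties using (↗↭↗⇒≋)
  open import Data.Product using (_,_)
  open import Data.Sum using (inj₁; inj₂)
  open import Data.Bool.Properties using (T-∨)
  open import Function.Bundles using (Equivalence)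
  open import Relation.Nullary.Decidable using (⌊_⌋; toWitness)
  open import Relation.Binary.PropositionalEquality

  _≟ᴸ_ = ≡-dec _≟_

  open SortingAlgorithm insertionSort using (sort-↭; sort-↗)

  rotate-↭ : ∀ {A : Set} k (xs : List A) → rotate k xs ↭ xs
  rotate-↭ k xs = ↭-trans (++-comm (drop k xs) (take k xs)) (↭-reflexive (take++drop≡id k xs))

  cycEq⇒↭ : ∀ {s t} → CycEq s t → s ↭ t
  cycEq⇒↭ (k , inj₁ refl) = rotate-↭ k _
  cycEq⇒↭ {t = t} (k , inj₂ refl) = ↭-trans (rotate-↭ k (reverse t)) (↭-reverse t)

  ↭⇒sort≡ : ∀ {s t} → s ↭ t → sort s ≡ sort t
  ↭⇒sort≡ {s} {t} s↭t = ≋⇒≡ (↗↭↗⇒≋ ≤-totalOrder (sort-↗ s) (sort-↗ t)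
    (↭⇒↭ₛ (↭-trans (sort-↭ s) (↭-trans s↭t (↭-sym (sort-↭ t))))))

  words : ℕ → List ℕ → List (List ℕ)
  words zero    A = [] ∷ []
  words (suc n) A = concatMap (λ v → map (v ∷_) (words n A)) A

  ∈-words : ∀ {A} t → All (_∈ A) t → t ∈ words (length t) A
  ∈-words []      []          = here refl
  ∈-words (v ∷ t) (v∈A ∷ t⊆A) =
    ∈-concatMap⁺ (λ v → map (v ∷_) (words (length t) _)) (Any.map (λ { refl → ∈-map⁺ (v ∷_) (∈-words t t⊆A) }) v∈A)

  cycEqAt? : List ℕ → List ℕ → ℕ → Bool
  cycEqAt? t s k = ⌊ t ≟ᴸ rotate k s ⌋ ∨ ⌊ t ≟ᴸ rotate k (reverse s) ⌋

  cycEq? : List ℕ → List ℕ → Bool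
  cycEq? t s = any (cycEqAt? t s) (upTo (length s))

  cycEq?-sound : ∀ t s → T (cycEq? t s) → CycEq t s
  cycEq?-sound t s holds with satisfied (any⁻ (cycEqAt? t s) (upTo (length s)) holds)
  ... | k , test with Equivalence.to (T-∨ {⌊ t ≟ᴸ rotate k s ⌋}) test
  ...   | inj₁ rotation   = k , inj₁ (toWitness {a? = t ≟ᴸ rotate k s} rotation)
  ...   | inj₂ reflection = k , inj₂ (toWitness {a? = t ≟ᴸ rotate k (reverse s)} reflection)

  -- Checks every rearrangement of s, enumerated as a word over the letters of s.
  rigid? : List ℕ → Bool
  rigid? s = all (λ t → cycEq? t s) (filter (λ t → sort t ≟ᴸ sort s) (words (length s) (deduplicate _≟_ s)))

  rigid?-sound : ∀ s → T (rigid? s) → ∀ {t} → t ↭ s → CycEq t s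
  rigid?-sound s rigid {t} t↭s = cycEq?-sound t s (All.lookup (all⁺ _ _ rigid) (∈-filter⁺ (λ t → sort t ≟ᴸ sort s)
    (subst (λ n → t ∈ words n _) (↭-length t↭s) (∈-words t (All.tabulate (λ v∈t → ∈-deduplicate⁺ _≟_ (∈-resp-↭ t↭s v∈t)))))
    (↭⇒sort≡ t↭s)))

  sort≡⇒↭ : ∀ {s t} → sort s ≡ sort t → s ↭ t
  sort≡⇒↭ {s} {t} sort-s≡sort-t = ↭-trans (↭-sym (sort-↭ s)) (↭-trans (↭-reflexive sort-s≡sort-t) (sort-↭ t))

module Arithmetic where
  open import Data.Nat
  open import Data.Nat.Properties
  open import Data.Nat.Tactic.RingSolver using (solve-∀)
  open import Relation.Binary.PropositionalEquality
  open import Data.Empty using (⊥-elim)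
  open import Data.Product using (_,_)

  private
    *-cancelˡ-≤′ : ∀ {m n} k → 0 < k → k * m ≤ k * n → m ≤ n
    *-cancelˡ-≤′ k@(suc _) _ = *-cancelˡ-≤ k

    *-cancelʳ-≤′ : ∀ {m n} k → 0 < k → m * k ≤ n * k → m ≤ n
    *-cancelʳ-≤′ {m} {n} k@(suc _) _ = *-cancelʳ-≤ m n k

    factor>0 : ∀ {M v w} → 0 < M → M ≡ v * w → 0 < w
    factor>0 {v = v} {w = zero} 0<M M≡v*0 = ⊥-elim (<-irrefl (sym (trans M≡v*0 (*-zeroʳ v))) 0<M)
    factor>0 {w = suc _} _ _ = s≤s z≤n

  -- M (n h) = 2 h W + M (2 h + 1) is Euler's relation for p = 2 h vertices of valency n,
  -- multiplied by M, where W = ∑ M / v over the face sizes v at a vertex.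

  length-bound : ∀ M n h W → 0 < M → M * (n * h) ≡ 2 * h * W + M * (2 * h + 1) → 4 * W ≤ n * M →
                 n * h ≤ 4 * h + 2
  length-bound M n h W 0<M euler 4W≤nM = *-cancelˡ-≤′ 2 (s≤s z≤n) (*-cancelˡ-≤′ M 0<M (+-cancelˡ-≤ (2 * h * (n * M)) _ _ (begin
    2 * h * (n * M) + M * (2 * (n * h)) ≡⟨ lhs M n h ⟩
    4 * (M * (n * h))                    ≡⟨ cong (4 *_) euler ⟩
    4 * (2 * h * W + M * (2 * h + 1))    ≡⟨ rhs M h W ⟩
    2 * h * (4 * W) + M * (2 * (4 * h + 2)) ≤⟨ +-monoˡ-≤ _ (*-monoʳ-≤ (2 * h) 4W≤nM) ⟩
    2 * h * (n * M) + M * (2 * (4 * h + 2)) ∎)))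
    where
    open ≤-Reasoning
    lhs : ∀ M n h → 2 * h * (n * M) + M * (2 * (n * h)) ≡ 4 * (M * (n * h))
    lhs = solve-∀
    rhs : ∀ M h W → 4 * (2 * h * W + M * (2 * h + 1)) ≡ 2 * h * (4 * W) + M * (2 * (4 * h + 2))
    rhs = solve-∀

  -- Divided by M h: 1/v = (n - 2)/2 - 1/(2h) - R/M ≥ e/(2k) - 1/(2h) ≥ e/(2k) - 1/v.
  entry-bound : ∀ M n h v w R k c e → 0 < M → 0 < h → M ≡ v * w → v ≤ 2 * h → k * R ≤ c * M →
                k * n ≡ 2 * k + 2 * c + e → M * (n * h) ≡ 2 * h * (w + R) + M * (2 * h + 1) →
                e * v ≤ 4 * k
  entry-bound M n h v w R k c e 0<M 0<h M≡vw v≤2h kR≤cM kn≡ euler = *-cancelʳ-≤′ (w * h) (*-mono-< 0<w 0<h) (begin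
    e * v * (w * h)          ≡⟨ evwh e v w h ⟩
    e * (v * w) * h          ≡⟨ cong (λ m → e * m * h) M≡vw ⟨
    e * M * h                ≤⟨ +-cancelˡ-≤ X _ _ k-euler ⟩
    2 * h * k * w + k * M    ≤⟨ +-monoʳ-≤ (2 * h * k * w) kM≤2hkw ⟩
    2 * h * k * w + 2 * h * k * w ≡⟨ double h k w ⟩
    4 * k * (w * h)          ∎)
    where
    open ≤-Reasoning
    evwh : ∀ e v w h → e * v * (w * h) ≡ e * (v * w) * h
    evwh = solve-∀
    0<w : 0 < w
    0<w = factor>0 {v = v} 0<M M≡vw
    X = 2 * k * h * M + 2 * c * h * M
    k-euler : X + e * M * h ≤ X + (2 * h * k * w + k * M)
    k-euler = begin
      X + e * M * h                            ≡⟨ expand M h k c e ⟩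
      M * h * (2 * k + 2 * c + e)              ≡⟨ cong (M * h *_) kn≡ ⟨
      M * h * (k * n)                          ≡⟨ regroup M h k n ⟩
      k * (M * (n * h))                        ≡⟨ cong (k *_) euler ⟩
      k * (2 * h * (w + R) + M * (2 * h + 1))  ≡⟨ distribute M h k w R ⟩
      2 * h * (k * R) + Y                      ≤⟨ +-monoˡ-≤ Y (*-monoʳ-≤ (2 * h) kR≤cM) ⟩
      2 * h * (c * M) + Y                      ≡⟨ collect M h k c w ⟩
      X + (2 * h * k * w + k * M)              ∎
      where
      Y = 2 * k * h * M + (2 * h * k * w + k * M)
      expand : ∀ M h k c e → 2 * k * h * M + 2 * c * h * M + e * M * h ≡ M * h * (2 * k + 2 * c + e)
      expand = solve-∀
      regroup : ∀ M h k n → M * h * (k * n) ≡ k * (M * (n * h))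
      regroup = solve-∀
      distribute : ∀ M h k w R → k * (2 * h * (w + R) + M * (2 * h + 1))
                               ≡ 2 * h * (k * R) + (2 * k * h * M + (2 * h * k * w + k * M))
      distribute = solve-∀
      collect : ∀ M h k c w → 2 * h * (c * M) + (2 * k * h * M + (2 * h * k * w + k * M))
                            ≡ 2 * k * h * M + 2 * c * h * M + (2 * h * k * w + k * M)
      collect = solve-∀
    kM≤2hkw : k * M ≤ 2 * h * k * w
    kM≤2hkw = begin
      k * M           ≡⟨ cong (k *_) M≡vw ⟩
      k * (v * w)     ≤⟨ *-monoʳ-≤ k (*-monoˡ-≤ w v≤2h) ⟩
      k * (2 * h * w) ≡⟨ shuffle h k w ⟩
      2 * h * k * w   ∎
      where
      shuffle : ∀ h k w → k * (2 * h * w) ≡ 2 * h * k * w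
      shuffle = solve-∀
    double : ∀ h k w → 2 * h * k * w + 2 * h * k * w ≡ 4 * k * (w * h)
    double = solve-∀

  12[b+c]≤5bc : ∀ b c → 4 ≤ b → 4 ≤ c → 10 ≤ b + c → 12 * (b + c) ≤ 5 * (b * c)
  12[b+c]≤5bc b c 4≤b 4≤c 10≤b+c
    with x , refl ← m≤n⇒∃[o]m+o≡n 4≤b | y , refl ← m≤n⇒∃[o]m+o≡n 4≤c = begin
    12 * (4 + x + (4 + y))           ≡⟨ lhs x y ⟩
    80 + 16 + 12 * (x + y)           ≤⟨ +-monoˡ-≤ _ (+-monoʳ-≤ 80 16≤8[x+y]) ⟩
    80 + 8 * (x + y) + 12 * (x + y)  ≤⟨ m≤m+n _ (5 * (x * y)) ⟩
    80 + 8 * (x + y) + 12 * (x + y) + 5 * (x * y) ≡⟨ rhs x y ⟩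
    5 * ((4 + x) * (4 + y))          ∎
    where
    open ≤-Reasoning
    16≤8[x+y] : 16 ≤ 8 * (x + y)
    16≤8[x+y] = *-monoʳ-≤ 8 (+-cancelˡ-≤ 8 2 (x + y) (≤-trans 10≤b+c (≤-reflexive (shuffle x y))))
      where
      shuffle : ∀ x y → 4 + x + (4 + y) ≡ 8 + (x + y)
      shuffle = solve-∀
    lhs : ∀ x y → 12 * (4 + x + (4 + y)) ≡ 80 + 16 + 12 * (x + y)
    lhs = solve-∀
    rhs : ∀ x y → 80 + 8 * (x + y) + 12 * (x + y) + 5 * (x * y) ≡ 5 * ((4 + x) * (4 + y))
    rhs = solve-∀

  -- For n = 3 two quadrangles give ∑ 1/v > 1/2, but Euler's relation demands 1/2 - 1/(2h).
  no-two-quadrangles : ∀ M h wa wb wc → 0 < M → M ≡ 4 * wb → M ≡ 4 * wc →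
                       M * (3 * h) ≢ 2 * h * (wa + (wb + wc)) + M * (2 * h + 1)
  no-two-quadrangles M h wa wb wc 0<M M≡4wb M≡4wc euler = <-irrefl (sym M≡0) 0<M
    where
    open ≡-Reasoning
    excess≡0 : 8 * h * wa + 4 * M ≡ 0
    excess≡0 = +-cancelˡ-≡ (12 * h * M) _ 0 (begin
      12 * h * M + (8 * h * wa + 4 * M)                          ≡⟨ spread M h wa ⟩
      8 * h * wa + 2 * h * M + 2 * h * M + 8 * h * M + 4 * M     ≡⟨ cong₂ (λ s t → 8 * h * wa + 2 * h * s + 2 * h * t + 8 * h * M + 4 * M) M≡4wb M≡4wc ⟩
      8 * h * wa + 2 * h * (4 * wb) + 2 * h * (4 * wc) + 8 * h * M + 4 * M ≡⟨ collect M h wa wb wc ⟩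
      4 * (2 * h * (wa + (wb + wc)) + M * (2 * h + 1))           ≡⟨ cong (4 *_) euler ⟨
      4 * (M * (3 * h))                                          ≡⟨ twelve M h ⟩
      12 * h * M + 0                                             ∎)
      where
      spread : ∀ M h wa → 12 * h * M + (8 * h * wa + 4 * M) ≡ 8 * h * wa + 2 * h * M + 2 * h * M + 8 * h * M + 4 * M
      spread = solve-∀
      collect : ∀ M h wa wb wc → 8 * h * wa + 2 * h * (4 * wb) + 2 * h * (4 * wc) + 8 * h * M + 4 * M
                               ≡ 4 * (2 * h * (wa + (wb + wc)) + M * (2 * h + 1))
      collect = solve-∀
      twelve : ∀ M h → 4 * (M * (3 * h)) ≡ 12 * h * M + 0
      twelve = solve-∀
    M≡0 : M ≡ 0
    M≡0 = *-cancelˡ-≡ M 0 4 (m+n≡0⇒n≡0 (8 * h * wa) excess≡0)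

  12[wb+wc]≤5M : ∀ M b c wb wc → 0 < b → 0 < c → M ≡ b * wb → M ≡ c * wc →
                 12 * (b + c) ≤ 5 * (b * c) → 12 * (wb + wc) ≤ 5 * M
  12[wb+wc]≤5M M b c wb wc 0<b 0<c M≡bwb M≡cwc 12[b+c]≤5bc = *-cancelˡ-≤′ (b * c) (*-mono-< 0<b 0<c) (begin
    b * c * (12 * (wb + wc))       ≡⟨ spread b c wb wc ⟩
    12 * (c * (b * wb) + b * (c * wc)) ≡⟨ cong₂ (λ s t → 12 * (c * s + b * t)) M≡bwb M≡cwc ⟨
    12 * (c * M + b * M)           ≡⟨ factor b c M ⟩
    M * (12 * (b + c))             ≤⟨ *-monoʳ-≤ M 12[b+c]≤5bc ⟩
    M * (5 * (b * c))              ≡⟨ swap b c M ⟩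
    b * c * (5 * M)                ∎)
    where
    open ≤-Reasoning
    spread : ∀ b c wb wc → b * c * (12 * (wb + wc)) ≡ 12 * (c * (b * wb) + b * (c * wc))
    spread = solve-∀
    factor : ∀ b c M → 12 * (c * M + b * M) ≡ M * (12 * (b + c))
    factor = solve-∀
    swap : ∀ b c M → M * (5 * (b * c)) ≡ b * c * (5 * M)
    swap = solve-∀

module FaceSizes where
  open FiniteSum using (_÷_; ÷-*)
  open Arithmetic
  open import Data.Nat
  open import Data.Nat.Properties
  open import Data.Nat.ListAction using (sum; product)
  open import Data.Nat.ListAction.Properties using (sum-↭; ∈⇒∣product)
  open import Data.Nat.DivMod using (_/_; m*n/n≡m)
  open import Data.Nat.Tactic.RingSolver using (solve-∀)
  open import Data.List using (List; []; _∷_; _++_; map; length)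
  open import Data.List.Membership.Propositional using (_∈_)
  open import Data.List.Membership.Propositional.Properties using (∈-∃++)
  open import Data.List.Relation.Unary.Any using (there)
  open import Data.List.Relation.Unary.All as All using (All; []; _∷_)
  open import Data.List.Relation.Binary.Permutation.Propositional using (_↭_; ↭-sym)
  open import Data.List.Relation.Binary.Permutation.Propositional.Properties using (shift; map⁺; ∈-resp-↭; ↭-length)
  open import Data.Product using (∃; _×_; _,_; proj₁; proj₂)
  open import Data.Sum using (_⊎_; inj₁; inj₂)
  open import Data.Empty using (⊥-elim)
  open import Relation.Nullary using (yes; no; contradiction)
  open import Relation.Binary.PropositionalEquality

  weights : ℕ → List ℕ → ℕ
  weights M vs = sum (map (M ÷_) vs)

  -- For the face sizes l at a vertex and p = 2 h vertices: V - E + F = -1 times product l.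
  EulerEquation : List ℕ → ℕ → Set
  EulerEquation l h = product l * (length l * h) ≡ 2 * h * weights (product l) l + product l * (2 * h + 1)

  EvenFaceSize : ℕ → Set
  EvenFaceSize v = ∃ λ r → v ≡ 2 * r × 2 ≤ r

  Admissible : List ℕ → ℕ → Set
  Admissible l h = All (λ v → EvenFaceSize v × v ≤ 2 * h) l

  ∈-↭-∷ : ∀ {v : ℕ} {l} → v ∈ l → ∃ λ rest → l ↭ v ∷ rest
  ∈-↭-∷ v∈l with ∈-∃++ v∈l
  ... | ys , zs , refl = ys ++ zs , shift _ ys zs

  private
    10≤ : ∀ r s → 5 ≤ r + s → 10 ≤ 2 * r + 2 * s
    10≤ r s 5≤r+s = ≤-trans (*-monoʳ-≤ 2 5≤r+s) (≤-reflexive (*-distribˡ-+ 2 r s))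

  quadrangle-pair-or-10≤ : ∀ {b c} → EvenFaceSize b → EvenFaceSize c → (b ≡ 4 × c ≡ 4) ⊎ 10 ≤ b + c
  quadrangle-pair-or-10≤ (2 , refl , _) (2 , refl , _) = inj₁ (refl , refl)
  quadrangle-pair-or-10≤ (2 , refl , _) (suc (suc (suc s)) , refl , _) = inj₂ (10≤ 2 (3 + s) (m≤m+n 5 s))
  quadrangle-pair-or-10≤ (suc (suc (suc r)) , refl , _) (s , refl , 2≤s) = inj₂ (10≤ (3 + r) s (+-mono-≤ (m≤m+n 3 r) 2≤s))
  quadrangle-pair-or-10≤ (0 , _ , ()) _
  quadrangle-pair-or-10≤ (1 , _ , s≤s ()) _
  quadrangle-pair-or-10≤ (2 , _ , _) (0 , _ , ())
  quadrangle-pair-or-10≤ (2 , _ , _) (1 , _ , s≤s ())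

  module _ {l h} (admissible : Admissible l h) where

    private
      M = product l

    4≤entry : ∀ {v} → v ∈ l → 4 ≤ v
    4≤entry v∈l with All.lookup admissible v∈l
    ... | (r , refl , 2≤r) , _ = *-monoʳ-≤ 2 2≤r

    entry≤2h : ∀ {v} → v ∈ l → v ≤ 2 * h
    entry≤2h v∈l = proj₂ (All.lookup admissible v∈l)

    M≡entry*weight : ∀ {v} → v ∈ l → M ≡ v * (M ÷ v)
    M≡entry*weight {v} v∈l = trans (sym (÷-* (∈⇒∣product v∈l))) (*-comm (M ÷ v) v)

    4*weight≤M : ∀ {v} → v ∈ l → 4 * (M ÷ v) ≤ M
    4*weight≤M {v} v∈l = subst (4 * (M ÷ v) ≤_) (sym (M≡entry*weight v∈l)) (*-monoˡ-≤ (M ÷ v) (4≤entry v∈l))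

    4*weights≤ : ∀ vs → All (_∈ l) vs → 4 * weights M vs ≤ length vs * M
    4*weights≤ []       []            = z≤n
    4*weights≤ (v ∷ vs) (v∈l ∷ vs⊆l) = begin
      4 * (M ÷ v + weights M vs)       ≡⟨ *-distribˡ-+ 4 (M ÷ v) _ ⟩
      4 * (M ÷ v) + 4 * weights M vs   ≤⟨ +-mono-≤ (4*weight≤M v∈l) (4*weights≤ vs vs⊆l) ⟩
      M + length vs * M                ∎
      where open ≤-Reasoning

    0<M : 0 < M
    0<M = product-pos l (All.tabulate (λ v∈l → <-≤-trans (s≤s z≤n) (4≤entry v∈l)))
      where
      product-pos : ∀ vs → All (0 <_) vs → 0 < product vs
      product-pos []       []           = s≤s z≤n
      product-pos (v ∷ vs) (0<v ∷ 0<vs) = *-mono-< 0<v (product-pos vs 0<vs)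

    weights-↭ : ∀ {vs us} → vs ↭ us → weights M vs ≡ weights M us
    weights-↭ vs↭us = sum-↭ (map⁺ (M ÷_) vs↭us)

    2≤h : ∀ {v} → v ∈ l → 2 ≤ h
    2≤h v∈l = *-cancelˡ-≤ 2 (≤-trans (4≤entry v∈l) (entry≤2h v∈l))

    module _ (euler : EulerEquation l h) where

      length*h≤ : length l * h ≤ 4 * h + 2
      length*h≤ = length-bound M (length l) h (weights M l) 0<M euler (4*weights≤ l (All.tabulate (λ v∈l → v∈l)))

      length≤5 : ∀ {v} → v ∈ l → length l ≤ 5
      length≤5 v∈l with length l ≤? 5
      ... | yes n≤5 = n≤5
      ... | no  n≰5 = ⊥-elim (<⇒≱ (2≤h v∈l) (*-cancelˡ-≤ 2 (+-cancelˡ-≤ (4 * h) (2 * h) 2 (begin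
        4 * h + 2 * h   ≡⟨ solve-∀′ h ⟩
        6 * h           ≤⟨ *-monoˡ-≤ h (≰⇒> n≰5) ⟩
        length l * h    ≤⟨ length*h≤ ⟩
        4 * h + 2       ∎))))
        where
        open ≤-Reasoning
        solve-∀′ : ∀ h → 4 * h + 2 * h ≡ 6 * h
        solve-∀′ = solve-∀

      entry≤4-at-length5 : length l ≡ 5 → ∀ {v} → v ∈ l → v ≤ 4
      entry≤4-at-length5 n≡5 v∈l = ≤-trans (entry≤2h v∈l) (*-monoʳ-≤ 2 h≤2)
        where
        h≤2 : h ≤ 2
        h≤2 = +-cancelˡ-≤ (4 * h) h 2 (subst (_≤ 4 * h + 2) (five h)
                                        (subst (λ n → n * h ≤ 4 * h + 2) n≡5 length*h≤))
          where
          five : ∀ h → 5 * h ≡ 4 * h + h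
          five = solve-∀

      euler-at : ∀ {v rest} → l ↭ v ∷ rest →
                 M * (length l * h) ≡ 2 * h * (M ÷ v + weights M rest) + M * (2 * h + 1)
      euler-at l↭v∷rest = trans euler (cong (λ W → 2 * h * W + M * (2 * h + 1)) (weights-↭ l↭v∷rest))

      entry-bound-at : ∀ {v rest} k c e → v ∈ l → l ↭ v ∷ rest → k * length l ≡ 2 * k + 2 * c + e →
                       k * weights M rest ≤ c * M → e * v ≤ 4 * k
      entry-bound-at {v} {rest} k c e v∈l l↭v∷rest kn≡ kR≤cM =
        entry-bound M (length l) h v (M ÷ v) (weights M rest) k c e 0<M (<-≤-trans (s≤s z≤n) (2≤h v∈l))
                    (M≡entry*weight v∈l) (entry≤2h v∈l) kR≤cM kn≡ (euler-at l↭v∷rest)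

      private
        rest⊆l : ∀ {v rest} → l ↭ v ∷ rest → All (_∈ l) rest
        rest⊆l l↭v∷rest = All.tabulate (λ u∈rest → ∈-resp-↭ (↭-sym l↭v∷rest) (there u∈rest))

      entry≤8-at-length4 : length l ≡ 4 → ∀ {v} → v ∈ l → v ≤ 8
      entry≤8-at-length4 n≡4 v∈l with ∈-↭-∷ v∈l
      ... | rest , l↭v∷rest = *-cancelˡ-≤ 2 (entry-bound-at 4 3 2 v∈l l↭v∷rest (cong (4 *_) n≡4) (begin
        4 * weights M rest   ≤⟨ 4*weights≤ rest (rest⊆l l↭v∷rest) ⟩
        length rest * M      ≡⟨ cong (_* M) (suc-injective (trans (sym (↭-length l↭v∷rest)) n≡4)) ⟩
        3 * M                ∎))
        where open ≤-Reasoning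

      entry≤24-at-length3 : length l ≡ 3 → ∀ {v} → v ∈ l → v ≤ 24
      entry≤24-at-length3 n≡3 {v} v∈l with ∈-↭-∷ v∈l
      ... | [] , l↭v = contradiction (trans (sym n≡3) (↭-length l↭v)) λ ()
      ... | _ ∷ [] , l↭v∷b = contradiction (trans (sym n≡3) (↭-length l↭v∷b)) λ ()
      ... | _ ∷ _ ∷ _ ∷ _ , l↭v∷rest = contradiction (trans (sym n≡3) (↭-length l↭v∷rest)) λ ()
      ... | b ∷ c ∷ [] , l↭v∷b∷c with rest⊆l l↭v∷b∷c
      ...   | b∈l ∷ c∈l ∷ [] =
        *-cancelˡ-≤ 2 (entry-bound-at 12 5 2 v∈l l↭v∷b∷c (cong (12 *_) n≡3) (begin
          12 * (M ÷ b + (M ÷ c + 0)) ≡⟨ cong (λ t → 12 * (M ÷ b + t)) (+-identityʳ (M ÷ c)) ⟩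
          12 * (M ÷ b + M ÷ c)       ≤⟨ 12[wb+wc]≤5M M b c (M ÷ b) (M ÷ c) (0<entry b∈l) (0<entry c∈l)
                                          (M≡entry*weight b∈l) (M≡entry*weight c∈l)
                                          (12[b+c]≤5bc b c (4≤entry b∈l) (4≤entry c∈l) 10≤b+c) ⟩
          5 * M                      ∎))
        where
        open ≤-Reasoning
        0<entry : ∀ {u} → u ∈ l → 0 < u
        0<entry u∈l = <-≤-trans (s≤s z≤n) (4≤entry u∈l)
        10≤b+c : 10 ≤ b + c
        10≤b+c with quadrangle-pair-or-10≤ (proj₁ (All.lookup admissible b∈l)) (proj₁ (All.lookup admissible c∈l))
        ... | inj₂ 10≤ = 10≤
        ... | inj₁ (refl , refl) = ⊥-elim (no-two-quadrangles M h (M ÷ v) (M ÷ 4) (M ÷ 4) 0<M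
              (M≡entry*weight b∈l) (M≡entry*weight c∈l)
              (trans (cong (λ n → M * (n * h)) (sym n≡3))
                     (trans (euler-at l↭v∷b∷c) (cong (λ t → 2 * h * (M ÷ v + (M ÷ 4 + t)) + M * (2 * h + 1)) (+-identityʳ _)))))

  private
    from3to5 : ∀ {n} → 3 ≤ n → n ≤ 5 → n ≡ 3 ⊎ n ≡ 4 ⊎ n ≡ 5
    from3to5 {3} _ _ = inj₁ refl
    from3to5 {4} _ _ = inj₂ (inj₁ refl)
    from3to5 {5} _ _ = inj₂ (inj₂ refl)
    from3to5 {suc (suc (suc (suc (suc (suc _)))))} _ (s≤s (s≤s (s≤s (s≤s (s≤s ())))))
    from3to5 {0} () _
    from3to5 {1} (s≤s ()) _
    from3to5 {2} (s≤s (s≤s ())) _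

  maxFaceSize : ℕ → ℕ
  maxFaceSize 3 = 24
  maxFaceSize 4 = 8
  maxFaceSize _ = 4

  module _ {l h} (admissible : Admissible l h) (euler : EulerEquation l h) where

    private
      at : ∀ {v n} → length l ≡ n → v ≤ maxFaceSize n → v ≤ maxFaceSize (length l)
      at {v} n≡ = subst (λ n → v ≤ maxFaceSize n) (sym n≡)

    entry≤maxFaceSize : 3 ≤ length l → ∀ {v} → v ∈ l → v ≤ maxFaceSize (length l)
    entry≤maxFaceSize 3≤n v∈l with from3to5 3≤n (length≤5 admissible euler v∈l)
    ... | inj₁ n≡3        = at n≡3 (entry≤24-at-length3 admissible euler n≡3 v∈l)
    ... | inj₂ (inj₁ n≡4) = at n≡4 (entry≤8-at-length4 admissible euler n≡4 v∈l)
    ... | inj₂ (inj₂ n≡5) = at n≡5 (entry≤4-at-length5 admissible euler n≡5 v∈l)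

  defect : List ℕ → ℕ
  defect l = product l * length l ∸ (2 * weights (product l) l + 2 * product l)

  height : List ℕ → ℕ
  height l = product l ÷ defect l

  module _ {l h} (euler : EulerEquation l h) where

    private
      M = product l
      W = weights M l

    h*defect≡M : h * defect l ≡ M
    h*defect≡M = begin
      h * (M * length l ∸ (2 * W + 2 * M))         ≡⟨ *-distribˡ-∸ h (M * length l) _ ⟩
      h * (M * length l) ∸ h * (2 * W + 2 * M)     ≡⟨ cong (_∸ h * (2 * W + 2 * M)) (trans (swap M (length l) h)
                                                           (trans euler (regroup h W M))) ⟩
      h * (2 * W + 2 * M) + M ∸ h * (2 * W + 2 * M) ≡⟨ m+n∸m≡n (h * (2 * W + 2 * M)) M ⟩
      M                                            ∎
      where
      open ≡-Reasoning
      swap : ∀ M n h → h * (M * n) ≡ M * (n * h)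
      swap = solve-∀
      regroup : ∀ h W M → 2 * h * W + M * (2 * h + 1) ≡ h * (2 * W + 2 * M) + M
      regroup = solve-∀

    height≡ : 0 < M → height l ≡ h
    height≡ 0<M with defect l in defect≡
    ... | zero  = contradiction (trans (sym h*defect≡M) (trans (cong (h *_) defect≡) (*-zeroʳ h))) (>⇒≢ 0<M)
    ... | suc d = trans (cong (_/ suc d) (trans (sym h*defect≡M) (cong (h *_) defect≡))) (m*n/n≡m h (suc d))

module Enumeration where
  open import Defs using (typeList)
  open FiniteSum using (𝟙)
  open CyclicSequences using (words; ∈-words)
  open FaceSizes
  open import Data.Nat
  open import Data.Nat.Properties using (_≟_; _≤?_; ≤-decTotalOrder; *-monoʳ-≤; *-comm)
  open import Data.Nat.ListAction using (sum)
  open import Data.Nat.Divisibility using (_∣_; _∣?_; divides)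
  open import Data.List using (List; []; _∷_; map; length; upTo; filter)
  open import Data.List.Properties using (≡-dec)
  open import Data.List.Membership.Propositional using (_∈_)
  open import Data.List.Membership.Propositional.Properties using (∈-filter⁺; ∈-upTo⁺)
  open import Data.List.Relation.Unary.All as All using (All; all?)
  open import Data.List.Relation.Unary.Any using (Any; any?; here)
  open import Data.List.Sort.InsertionSort ≤-decTotalOrder using (sort)
  open import Data.Product using (_×_; _,_; proj₁; proj₂)
  open import Data.Sum using (_⊎_)
  open import Relation.Nullary using (Dec; _×-dec_; _⊎-dec_)
  open import Relation.Nullary.Decidable using (from-yes)
  open import Relation.Binary.PropositionalEquality

  multiplicity : ℕ → List ℕ → ℕ
  multiplicity v l = sum (map (λ u → 𝟙 (u ≟ v)) l)

  -- The 2 h · multiplicity v l corners of size v come in whole faces of v corners.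
  Divisible : List ℕ → ℕ → Set
  Divisible l h = All (λ v → v ∣ 2 * h * multiplicity v l) l

  -- arithmetic solutions that no graph realises
  exceptions : List (List ℕ × ℕ)
  exceptions = (6 ∷ 8 ∷ 8 ∷ [] , 12) ∷ (4 ∷ 4 ∷ 6 ∷ 6 ∷ [] , 6) ∷ []

  Matches : List ℕ → ℕ → List ℕ × ℕ → Set
  Matches l p (s , q) = q ≡ p × sort l ≡ sort s

  Classified : List ℕ → ℕ → Set
  Classified l p = Any (Matches l p) typeList ⊎ Any (Matches l p) exceptions

  private
    _≟ᴸ_ = ≡-dec _≟_

    matches? : ∀ l p sq → Dec (Matches l p sq)
    matches? l p (s , q) = (q ≟ p) ×-dec (sort l ≟ᴸ sort s)

    Solution : List ℕ → Set
    Solution l = EulerEquation l (height l) × All (λ v → v ≤ 2 * height l × v ∣ 2 * height l * multiplicity v l) l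

    solution? : ∀ l → Dec (Solution l)
    solution? l = (_ ≟ _) ×-dec all? (λ v → (v ≤? 2 * height l) ×-dec (v ∣? 2 * height l * multiplicity v l)) l

    sizesUpTo : ℕ → List ℕ
    sizesUpTo b = filter (λ v → (4 ≤? v) ×-dec (2 ∣? v)) (upTo (suc b))

    candidates : ℕ → List (List ℕ)
    candidates n = filter solution? (words n (sizesUpTo (maxFaceSize n)))

    Complete : ℕ → Set
    Complete n = All (λ l → Classified l (2 * height l)) (candidates n)

    complete? : ∀ n → Dec (Complete n)
    complete? n = all? (λ l → any? (matches? l (2 * height l)) typeList ⊎-dec any? (matches? l (2 * height l)) exceptions)
                       (candidates n)

    complete : ∀ n → 3 ≤ n → n ≤ 5 → Complete n
    complete 3 _ _ = from-yes (complete? 3)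
    complete 4 _ _ = from-yes (complete? 4)
    complete 5 _ _ = from-yes (complete? 5)
    complete (suc (suc (suc (suc (suc (suc _)))))) _ (s≤s (s≤s (s≤s (s≤s (s≤s ())))))
    complete 0 () _
    complete 1 (s≤s ()) _
    complete 2 (s≤s (s≤s ())) _

    ∈-sizesUpTo : ∀ {v b} → EvenFaceSize v → v ≤ b → v ∈ sizesUpTo b
    ∈-sizesUpTo (r , refl , 2≤r) v≤b = ∈-filter⁺ (λ v → (4 ≤? v) ×-dec (2 ∣? v)) (∈-upTo⁺ (s≤s v≤b))
                                         (*-monoʳ-≤ 2 2≤r , divides r (*-comm 2 r))

  classify : ∀ {l h} → 3 ≤ length l → Admissible l h → Divisible l h → EulerEquation l h → Classified l (2 * h)
  classify {l@(v ∷ _)} {h} 3≤n admissible divisible euler =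
    subst (λ k → Classified l (2 * k)) (height≡ {l} {h} euler (0<M {l} {h} admissible))
          (All.lookup (complete (length l) 3≤n (length≤5 {l} {h} admissible euler v∈l)) (∈-filter⁺ solution? l∈words solution))
    where
    v∈l : v ∈ l
    v∈l = here refl
    l∈words : l ∈ words (length l) (sizesUpTo (maxFaceSize (length l)))
    l∈words = ∈-words l (All.tabulate (λ u∈l →
                ∈-sizesUpTo (proj₁ (All.lookup admissible u∈l)) (entry≤maxFaceSize {l} {h} admissible euler 3≤n u∈l)))
    solution : Solution l
    solution = subst (λ k → EulerEquation l k × All (λ u → u ≤ 2 * k × u ∣ 2 * k * multiplicity u l) l)
                     (sym (height≡ {l} {h} euler (0<M {l} {h} admissible)))
                     (euler , All.tabulate (λ u∈l → proj₂ (All.lookup admissible u∈l) , All.lookup divisible u∈l))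

module Classification where
  open import Defs
  open FiniteSum
  open Faces
  open CyclicSequences
  open FaceSizes
  open Enumeration
  open import Data.Nat hiding (_≟_)
  open import Data.Nat.Properties hiding (_≟_)
  open import Data.Nat.Properties using () renaming (_≟_ to _≟ℕ_)
  open import Data.Nat.Divisibility using (_∣_; _∣?_)
  open import Data.Nat.ListAction using (product)
  import Data.Nat.ListAction as List
  open import Data.Nat.ListAction.Properties using (sum-↭; ∈⇒∣product)
  open import Data.Nat.DivMod using (_/_; m*n/n≡m)
  open import Data.Nat.Tactic.RingSolver using (solve-∀)
  open import Data.Integer as ℤ using (+_; -[1+_])
  import Data.Integer.Properties as ℤ
  open import Data.Integer.Tactic.RingSolver renaming (solve-∀ to ℤ-solve-∀)
  open import Data.Fin using (Fin; toℕ; fromℕ<)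
  open import Data.Fin.Properties using (toℕ-fromℕ<; any?)
  open import Data.List using (List; []; _∷_; map; allFin; length)
  open import Data.List.Properties using (map-∘; length-map; length-tabulate)
  open import Data.List.Membership.Propositional using (_∈_)
  open import Data.List.Membership.Propositional.Properties using (∈-map⁺; ∈-map⁻; ∈-allFin)
  open import Data.List.Relation.Binary.Permutation.Propositional using (_↭_; ↭-sym; ↭-trans)
  open import Data.List.Relation.Binary.Permutation.Propositional.Properties using (map⁺; ∈-resp-↭)
  open import Data.List.Relation.Unary.All as All using (All)
  open import Data.List.Relation.Unary.All.Properties using (all⁺)
  open import Data.Bool using (T)
  open import Data.Product using (∃; _×_; _,_; proj₁)
  open import Data.Sum using (_⊎_; inj₁; inj₂; [_,_]′)
  open import Function using (case_of_; _∘_)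
  open import Relation.Nullary using (¬_; Dec; _×-dec_)
  open import Relation.Nullary.Decidable using (from-no)
  open import Data.Empty using (⊥; ⊥-elim)
  open import Data.List.Relation.Unary.Any using (Any; here; there)
  open import Data.List.Membership.Propositional using (find)
  open import Relation.Binary.PropositionalEquality

  typeList-rigid : All (λ sq → T (rigid? (proj₁ sq))) typeList
  typeList-rigid = all⁺ (λ sq → rigid? (proj₁ sq)) typeList _

  -- the vertices split among faces of sizes qa (at least one) and qb
  Splits : ℕ → ℕ → ℕ → Set
  Splits n qa qb = ∃ λ (c : Fin (suc n)) → 0 < toℕ c × qa ∣ toℕ c × qb ∣ n ∸ toℕ c

  splits? : ∀ n qa qb → Dec (Splits n qa qb)
  splits? n qa qb = any? (λ c → (0 <? toℕ c) ×-dec (qa ∣? toℕ c) ×-dec (qb ∣? n ∸ toℕ c))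

  euler⇒F+V+1≡E : ∀ {d p} (G : ColoredGraph d p) → euler G ≡ -[1+ 0 ] → F G + p + 1 ≡ E G
  euler⇒F+V+1≡E {p = p} G χ≡-1 = ℤ.+-injective (begin
    + (F G + p + 1)                     ≡⟨ ℤ.pos-+ (F G + p) 1 ⟩
    + (F G + p) ℤ.+ + 1                 ≡⟨ cong (ℤ._+ + 1) (ℤ.pos-+ (F G) p) ⟩
    + F G ℤ.+ + p ℤ.+ + 1               ≡⟨ rearrange (+ p) (+ E G) (+ F G) ⟩
    euler G ℤ.+ + E G ℤ.+ + 1           ≡⟨ cong (λ χ → χ ℤ.+ + E G ℤ.+ + 1) χ≡-1 ⟩
    -[1+ 0 ] ℤ.+ + E G ℤ.+ + 1          ≡⟨ cancel (+ E G) ⟩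
    + E G                               ∎)
    where
    open ≡-Reasoning
    rearrange : ∀ V E F → F ℤ.+ V ℤ.+ + 1 ≡ V ℤ.- E ℤ.+ F ℤ.+ E ℤ.+ + 1
    rearrange = ℤ-solve-∀
    cancel : ∀ E → -[1+ 0 ] ℤ.+ E ℤ.+ + 1 ≡ E
    cancel = ℤ-solve-∀

  module _ {d p : ℕ} (G : ColoredGraph d p) (sides≥4 : AllFacesAtLeast4 G) (semi : SemiEquivelar G) (x₀ : Fin p) where

    module F (i : Fin (suc d)) = Faces G i (sides≥4 i)

    private
      l = faceSeq G x₀
      M = product l

    faceSeq-↭ : ∀ y → faceSeq G y ↭ l
    faceSeq-↭ y = cycEq⇒↭ (semi y x₀)

    sum-faceSeq : ∀ f y → List.sum (map f (faceSeq G y)) ≡ ∑[ i < suc d ] f (faceSides G i y)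
    sum-faceSeq f y = trans (cong List.sum (sym (map-∘ (allFin (suc d)))))
                            (sum-map-allFin (suc d) (λ i → f (faceSides G i y)))

    ∑-colours : ∀ f y → ∑[ i < suc d ] f (faceSides G i y) ≡ List.sum (map f l)
    ∑-colours f y = trans (sym (sum-faceSeq f y)) (sum-↭ (map⁺ f (faceSeq-↭ y)))

    faceSides∈l : ∀ i y → faceSides G i y ∈ l
    faceSides∈l i y = ∈-resp-↭ (faceSeq-↭ y) (∈-map⁺ (λ i → faceSides G i y) (∈-allFin i))

    length-l : length l ≡ suc d
    length-l = trans (length-map _ (allFin (suc d))) (length-tabulate (λ i → i))

    module _ {h : ℕ} (p≡2h : p ≡ 2 * h) where

      admissible : Admissible l h
      admissible = All.tabulate λ v∈l → case ∈-map⁻ (λ i → faceSides G i x₀) v∈l of λ where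
        (i , _ , refl) → (F.ρ i x₀ , refl , F.2≤ρ i x₀) , subst (faceSides G i x₀ ≤_) p≡2h (F.faceSides≤p i x₀)

      divisible : Divisible l h
      divisible = All.tabulate λ {v} _ → subst (v ∣_) (#faces≡ v) (∣-∑ v _ (λ i → F.∣-#faceSides≡ i v))
        where
        #faces≡ : ∀ v → ∑[ i < suc d ] ∑[ y < p ] 𝟙 (faceSides G i y ≟ℕ v) ≡ 2 * h * multiplicity v l
        #faces≡ v = begin
          ∑[ i < suc d ] ∑[ y < p ] 𝟙 (faceSides G i y ≟ℕ v) ≡⟨ ∑-comm (λ i y → 𝟙 (faceSides G i y ≟ℕ v)) ⟩
          ∑[ y < p ] ∑[ i < suc d ] 𝟙 (faceSides G i y ≟ℕ v) ≡⟨ sum-cong-≗ {p} (∑-colours (λ u → 𝟙 (u ≟ℕ v))) ⟩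
          ∑[ y < p ] multiplicity v l                        ≡⟨ ∑-const p (multiplicity v l) ⟩
          p * multiplicity v l                               ≡⟨ cong (_* multiplicity v l) p≡2h ⟩
          2 * h * multiplicity v l                           ∎
          where open ≡-Reasoning

      M*F≡p*W : M * F G ≡ p * weights M l
      M*F≡p*W = begin
        M * F G                                          ≡⟨ cong (M *_) (sum-map-allFin (suc d) (numFaces G)) ⟩
        M * ∑[ i < suc d ] numFaces G i                  ≡⟨ *-distribˡ-sum M (numFaces G) ⟩
        ∑[ i < suc d ] (M * numFaces G i)                ≡⟨ sum-cong-≗ {suc d} (λ i → F.∑-÷-faceSides i M
                                                                (λ y → ∈⇒∣product (faceSides∈l i y))) ⟨
        ∑[ i < suc d ] ∑[ y < p ] (M ÷ faceSides G i y)  ≡⟨ ∑-comm (λ i y → M ÷ faceSides G i y) ⟩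
        ∑[ y < p ] ∑[ i < suc d ] (M ÷ faceSides G i y)  ≡⟨ sum-cong-≗ {p} (∑-colours (M ÷_)) ⟩
        ∑[ y < p ] weights M l                           ≡⟨ ∑-const p (weights M l) ⟩
        p * weights M l                                  ∎
        where open ≡-Reasoning

      eulerEquation : euler G ≡ -[1+ 0 ] → EulerEquation l h
      eulerEquation χ≡-1 = begin
        M * (length l * h)                ≡⟨ cong (λ n → M * (n * h)) length-l ⟩
        M * (suc d * h)                   ≡⟨ cong (λ k → M * (suc d * k)) p/2≡h ⟨
        M * E G                           ≡⟨ cong (M *_) (euler⇒F+V+1≡E G χ≡-1) ⟨
        M * (F G + p + 1)                 ≡⟨ distrib M (F G) p ⟩
        M * F G + M * (p + 1)             ≡⟨ cong (_+ M * (p + 1)) M*F≡p*W ⟩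
        p * weights M l + M * (p + 1)     ≡⟨ cong (λ k → k * weights M l + M * (k + 1)) p≡2h ⟩
        2 * h * weights M l + M * (2 * h + 1) ∎
        where
        open ≡-Reasoning
        p/2≡h : p / 2 ≡ h
        p/2≡h = trans (cong (_/ 2) (trans p≡2h (*-comm 2 h))) (m*n/n≡m h 2)
        distrib : ∀ M F p → M * (F + p + 1) ≡ M * F + M * (p + 1)
        distrib = solve-∀


    two-sizes-split : ∀ j qa qb → qa ≢ qb → (∀ y → faceSides G j y ≡ qa ⊎ faceSides G j y ≡ qb) →
                      faceSides G j x₀ ≡ qa → Splits p qa qb
    two-sizes-split j qa qb qa≢qb two-sizes fs≡qa =
      fromℕ< (s≤s c₁≤p) , subst (0 <_) (sym toℕc≡c₁) 0<c₁ ,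
      subst (qa ∣_) (sym toℕc≡c₁) (F.∣-#faceSides≡ j qa) ,
      subst (qb ∣_) (trans (sym (m+n∸m≡n c₁ c₂)) (cong₂ _∸_ c₁+c₂≡p (sym toℕc≡c₁))) (F.∣-#faceSides≡ j qb)
      where
      c₁ c₂ : ℕ
      c₁ = ∑[ y < p ] 𝟙 (faceSides G j y ≟ℕ qa)
      c₂ = ∑[ y < p ] 𝟙 (faceSides G j y ≟ℕ qb)
      c₁+c₂≡p : c₁ + c₂ ≡ p
      c₁+c₂≡p = begin
        c₁ + c₂                ≡⟨ ∑-distrib-+ (λ y → 𝟙 (faceSides G j y ≟ℕ qa)) _ ⟨
        ∑[ y < p ] (𝟙 (faceSides G j y ≟ℕ qa) + 𝟙 (faceSides G j y ≟ℕ qb)) ≡⟨ sum-cong-≗ {p} one-size ⟩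
        ∑[ y < p ] 1           ≡⟨ trans (∑-const p 1) (*-identityʳ p) ⟩
        p                      ∎
        where
        open ≡-Reasoning
        one-size : ∀ y → 𝟙 (faceSides G j y ≟ℕ qa) + 𝟙 (faceSides G j y ≟ℕ qb) ≡ 1
        one-size y with two-sizes y
        ... | inj₁ ≡qa = cong₂ _+_ (𝟙-yes (_ ≟ℕ qa) ≡qa) (𝟙-no (_ ≟ℕ qb) (λ ≡qb → qa≢qb (trans (sym ≡qa) ≡qb)))
        ... | inj₂ ≡qb = cong₂ _+_ (𝟙-no (_ ≟ℕ qa) (λ ≡qa → qa≢qb (trans (sym ≡qa) ≡qb))) (𝟙-yes (_ ≟ℕ qb) ≡qb)
      c₁≤p : c₁ ≤ p
      c₁≤p = subst (c₁ ≤_) c₁+c₂≡p (m≤m+n c₁ c₂)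
      toℕc≡c₁ : toℕ (fromℕ< (s≤s c₁≤p)) ≡ c₁
      toℕc≡c₁ = toℕ-fromℕ< (s≤s c₁≤p)
      0<c₁ : 0 < c₁
      0<c₁ = <-≤-trans (≤-reflexive (sym (𝟙-yes (_ ≟ℕ qa) fs≡qa))) (term≤∑ (λ y → 𝟙 (faceSides G j y ≟ℕ qa)) x₀)

    two-sizes-impossible : ∀ {s qa qb} → l ↭ s → qa ∈ s → qa ≢ qb → (∀ {v} → v ∈ s → v ≡ qa ⊎ v ≡ qb) →
                           ¬ Splits p qa qb → ⊥
    two-sizes-impossible l↭s qa∈s qa≢qb two-sizes no-split with ∈-map⁻ (λ i → faceSides G i x₀) (∈-resp-↭ (↭-sym l↭s) qa∈s)
    ... | j , _ , qa≡ = no-split (two-sizes-split j _ _ qa≢qb (λ y → two-sizes (∈-resp-↭ l↭s (faceSides∈l j y))) (sym qa≡))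

    not-exceptional : Any (Matches l p) exceptions → ⊥
    not-exceptional (here (12≡p , sort≡)) = two-sizes-impossible (sort≡⇒↭ {l} {6 ∷ 8 ∷ 8 ∷ []} sort≡) (there (here refl)) (λ ())
      (λ { (here refl) → inj₂ refl ; (there (here refl)) → inj₁ refl ; (there (there (here refl))) → inj₁ refl })
      (subst (λ n → ¬ Splits n 8 6) 12≡p (from-no (splits? 12 8 6)))
    not-exceptional (there (here (6≡p , sort≡))) = two-sizes-impossible (sort≡⇒↭ {l} {4 ∷ 4 ∷ 6 ∷ 6 ∷ []} sort≡) (here refl) (λ ())
      (λ { (here refl) → inj₁ refl ; (there (here refl)) → inj₁ refl
         ; (there (there (here refl))) → inj₂ refl ; (there (there (there (here refl)))) → inj₂ refl })
      (subst (λ n → ¬ Splits n 4 6) 6≡p (from-no (splits? 6 4 6)))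

    listed⇒ofType : Any (Matches l p) typeList → ∃ λ s → ∃ λ q → ((s , q) ∈ typeList) × OfType G s q
    listed⇒ofType listed with find listed
    ... | (s , q) , sq∈typeList , q≡p , sort≡ = s , q , sq∈typeList , sym q≡p , λ x →
      rigid?-sound s (All.lookup typeList-rigid sq∈typeList) (↭-trans (faceSeq-↭ x) (sort≡⇒↭ sort≡))

    classification : 2 ≤ d → ∀ {h} → p ≡ 2 * h → euler G ≡ -[1+ 0 ] →
                     ∃ λ s → ∃ λ q → ((s , q) ∈ typeList) × OfType G s q
    classification 2≤d {h} p≡2h χ≡-1 =
      [ listed⇒ofType , ⊥-elim ∘ not-exceptional ]′
        (subst (Classified l) (sym p≡2h)
          (classify {l} {h} 3≤n (admissible {h} p≡2h) (divisible {h} p≡2h) (eulerEquation {h} p≡2h χ≡-1)))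
      where
      3≤n : 3 ≤ length l
      3≤n = subst (3 ≤_) (sym length-l) (s≤s 2≤d)

lemma3p1 : (d p : ℕ) → 2 ≤ d → (G : ColoredGraph d p) → Connected G
    → AllFacesAtLeast4 G → SemiEquivelar G → euler G ≡ -[1+ 0 ]
    → ∃ λ s → ∃ λ q → ((s , q) ∈ typeList) × OfType G s q
lemma3p1 d p 2≤d G _ sides≥4 semi χ≡-1 with Faces.2∣p G zero (sides≥4 zero)
... | divides h p≡h*2 = Classification.classification G sides≥4 semi (fromℕ< (nonempty G)) 2≤d {h} (trans p≡h*2 (*-comm h 2)) χ≡-1
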